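{- For every integer $n\geq 0$: (1) $\displaystyle\sum_{k=0}^n(-1)^{n-k}\binom{n}{k}(y+1)^{n-k}\mathcal{B}_{k+1}(x,y)=\mathcal{F}_n(x)$; (2) $\displaystyle\sum_{k=0}^n(-1)^{n-k}\binom{n}{k}(y+1)^{n-k}\mathcal{N}_{k+1}(x,y)=\begin{cases}x^{n/2}C_{n/2},&n\text{ even},\\0,&n\text{ odd}.\end{cases}$
   Context: For a set partition $\Lambda$ of a finite set of integers, $(i,j)$ with $i<j$ is an arc if $i,j$ share a block and $j$ is the least element of that block greater than $i$; $\mathrm{Arc}(\Lambda)$ is the set of arcs and $\mathrm{Cov}(\Lambda)$ the arcs of the form $(i,i+1)$. Noncrossing: no arcs $(i,k),(j,l)$ with $i<j<k<l$. Feasible: every block has at least two elements. $\Pi(n)$, $\mathrm{NC}(n)$: all, resp. noncrossing, partitions of $[n]=\{1,\dots,n\}$ ($\Pi(0)=\{\varnothing\}$). $\mathcal{B}_n(x,y)=\sum_{\Lambda\in\Pi(n)}x^{|\mathrm{Arc}(\Lambda)\setminus\mathrm{Cov}(\Lambda)|}y^{|\mathrm{Cov}(\Lambda)|}$, $\mathcal{N}_n(x,y)$ the same sum over $\mathrm{NC}(n)$, $\mathcal{F}_n(x)=\sum_{\text{feasible }\Lambda\in\Pi(n)}x^{|\mathrm{Arc}(\Lambda)|}$, $C_k=\frac{1}{k+1}\binom{2k}{k}$. -}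

module Defs where

open import Data.Bool using (Bool; true; false; _∧_; _∨_; not; if_then_else_)
open import Data.Nat as ℕ using (ℕ; zero; suc; _<ᵇ_; _≡ᵇ_; _∸_)
open import Data.Nat.Combinatorics using (_C_)
open import Data.Nat.DivMod using (_/_)
open import Data.Integer as ℤ using (ℤ; +_; -[1+_])
open import Data.List using (List; []; _∷_; _++_; map; concatMap; filter; length; foldr; upTo; applyUpTo)
open import Data.Bool.ListAction using (all; any)
open import Relation.Nullary.Decidable using (T?)
open import Data.Product using (_×_; _,_; proj₁; proj₂)
open import Function using (_∘_)

-- Set partitions of [n] = {1,…,n}, encoded (bijectively) as restricted
-- growth strings: a list (a₁,…,aₙ) of block labels with a₁ = 0 and
-- aᵢ ≤ 1 + max(a₁,…,aᵢ₋₁). Position i lies in block aᵢ; two positions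
-- share a block iff they carry the same label.  Each set partition of
-- [n] occurs exactly once in the list `Π n` (blocks are labelled in order
-- of their least elements).

-- restricted growth strings of length n, paired with their number of blocks
rgs : ℕ → List (List ℕ × ℕ)
rgs zero    = ([] , 0) ∷ []
rgs (suc n) = concatMap ext (rgs n)
  where
  ext : List ℕ × ℕ → List (List ℕ × ℕ)
  ext (s , m) = map (λ l → (s ++ (l ∷ [])) , (if l ≡ᵇ m then suc m else m)) (upTo (suc m))

Partition : Set
Partition = List ℕ

Π : ℕ → List Partition
Π n = map proj₁ (rgs n)

nBlocks : Partition → ℕ
nBlocks s = go s 0
  where
  go : List ℕ → ℕ → ℕ
  go []      m = m
  go (a ∷ t) m = go t (if a <ᵇ m then m else suc a)

-- label of position i (1-based); positions are 1 … length s
lab : Partition → ℕ → ℕ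
lab []      _             = 0
lab (a ∷ s) zero          = 0
lab (a ∷ s) (suc zero)    = a
lab (a ∷ s) (suc (suc i)) = lab s (suc i)

positions : Partition → List ℕ
positions s = applyUpTo suc (length s)

isArc : Partition → ℕ → ℕ → Bool
isArc s i j = (i <ᵇ j) ∧ (lab s i ≡ᵇ lab s j)
              ∧ all (λ k → not ((i <ᵇ k) ∧ (k <ᵇ j) ∧ (lab s k ≡ᵇ lab s i))) (positions s)

Arc : Partition → List (ℕ × ℕ)
Arc s = concatMap (λ i → concatMap (λ j → if isArc s i j then (i , j) ∷ [] else []) (positions s))
                  (positions s)

isCov : ℕ × ℕ → Bool
isCov (i , j) = j ≡ᵇ suc i

nCov : Partition → ℕ
nCov s = length (Data.List.filter (λ a → T? (isCov a)) (Arc s))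

nArc : Partition → ℕ
nArc s = length (Arc s)

nNonCov : Partition → ℕ
nNonCov s = nArc s ∸ nCov s

crosses : ℕ × ℕ → ℕ × ℕ → Bool
crosses (i , k) (j , l) = (i <ᵇ j) ∧ (j <ᵇ k) ∧ (k <ᵇ l)

isNC : Partition → Bool
isNC s = not (any (λ a → any (λ b → crosses a b) (Arc s)) (Arc s))

blockSize : Partition → ℕ → ℕ
blockSize s b = length (Data.List.filter (λ a → a ℕ.≟ b) s)

isFeasible : Partition → Bool
isFeasible s = all (λ b → 1 <ᵇ blockSize s b) (upTo (nBlocks s))

NC : ℕ → List Partition
NC n = Data.List.filter (λ s → T? (isNC s)) (Π n)

Feasible : ℕ → List Partition
Feasible n = Data.List.filter (λ s → T? (isFeasible s)) (Π n)

-- Polynomials are represented by their evaluation at integers x y.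

sumℤ : List ℤ → ℤ
sumℤ = foldr ℤ._+_ (+ 0)

𝓑 : ℕ → ℤ → ℤ → ℤ
𝓑 n x y = sumℤ (map (λ s → (x ℤ.^ nNonCov s) ℤ.* (y ℤ.^ nCov s)) (Π n))

𝓝 : ℕ → ℤ → ℤ → ℤ
𝓝 n x y = sumℤ (map (λ s → (x ℤ.^ nNonCov s) ℤ.* (y ℤ.^ nCov s)) (NC n))

𝓕 : ℕ → ℤ → ℤ
𝓕 n x = sumℤ (map (λ s → x ℤ.^ nArc s) (Feasible n))

catalan : ℕ → ℕ
catalan k = ((2 ℕ.* k) C k) / suc k

transform : (ℕ → ℤ) → ℤ → ℕ → ℤ
transform P y n =
  sumℤ (map (λ k → (-[1+ 0 ] ℤ.^ (n ∸ k)) ℤ.* (+ (n C k)) ℤ.* ((y ℤ.+ + 1) ℤ.^ (n ∸ k)) ℤ.* P (suc k))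
            (upTo (suc n)))

module Submission where

-- Partitions are generated as restricted growth strings, one letter at a time.
-- Appending a letter l only adds the arc (lastPos l, n+1), when l is an old
-- label, and this arc is covering iff l is the last letter.  So a weighted sum
-- over strings of length n+1, with the weight carried by a function φ of a small
-- state, is the sum over length n with φ replaced by Tφ for a linear transfer
-- operator T: all partitions (state: number of blocks) give 𝓑ₖ₊₁ = (Tᵏ1)(1),
-- noncrossing ones (state: depth of the open-block stack) give 𝓝ₖ₊₁ = (T_NCᵏ1)(1),
-- and tracking singletons (state: singletons, larger blocks) gives 𝓕ₙ = (Mⁿδ)(0,0).
-- The binomial transform of the Aᵏφ is (A - u)ⁿφ with u = y+1.  Binomial sums
-- intertwine T - u with M (part 1) and T_NC - u with a ballot walk
-- ψ(e) ↦ ψ(e+1) + xψ(e-1), whose n-step weight from height 0 is x^m Cₘ for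
-- n = 2m and 0 for odd n (part 2).

open import Data.Integer.Base using (ℤ)

module RangeSums where

  open import Data.Nat
  open import Data.Nat.Properties
  open import Data.Bool using (Bool; true; false; _∧_; _∨_; if_then_else_)
  open import Algebra.Bundles using (CommutativeMonoid)
  open import Algebra.Properties.CommutativeSemigroup +-commutativeSemigroup using () renaming (interchange to +-interchange)
  open import Data.Bool.Properties using (∨-commutativeMonoid; ∨-assoc; ∧-assoc; ∨-identityʳ; ∧-identityʳ)
  open import Algebra.Properties.CommutativeSemigroup (CommutativeMonoid.commutativeSemigroup ∨-commutativeMonoid) using () renaming (interchange to ∨-interchange)
  open import Data.List using (List; []; _∷_; _++_; map; concatMap; concat; filter; length; foldr; applyUpTo)
  open import Data.Bool.ListAction using (all; any)
  open import Relation.Nullary.Decidable using (T?)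
  open import Relation.Binary.PropositionalEquality
  open import Function using (_∘_)
  open import Relation.Nullary using (yes; no)
  open import Data.Empty using (⊥-elim)

  eqb-refl : ∀ n → (n ≡ᵇ n) ≡ true
  eqb-refl zero = refl
  eqb-refl (suc n) = eqb-refl n

  eqb-≡ : ∀ m n → (m ≡ᵇ n) ≡ true → m ≡ n
  eqb-≡ zero zero _ = refl
  eqb-≡ zero (suc n) ()
  eqb-≡ (suc m) zero ()
  eqb-≡ (suc m) (suc n) e = cong suc (eqb-≡ m n e)

  eqb-≢ : ∀ m n → m ≢ n → (m ≡ᵇ n) ≡ false
  eqb-≢ zero zero ne = ⊥-elim (ne refl)
  eqb-≢ zero (suc n) ne = refl
  eqb-≢ (suc m) zero ne = refl
  eqb-≢ (suc m) (suc n) ne = eqb-≢ m n (λ e → ne (cong suc e))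

  ltb-true : ∀ m n → m < n → (m <ᵇ n) ≡ true
  ltb-true zero (suc n) _ = refl
  ltb-true (suc m) (suc n) (s≤s p) = ltb-true m n p

  ltb-false : ∀ m n → n ≤ m → (m <ᵇ n) ≡ false
  ltb-false m zero _ = refl
  ltb-false (suc m) (suc n) (s≤s p) = ltb-false m n p

  ltb-sound : ∀ m n → (m <ᵇ n) ≡ true → m < n
  ltb-sound zero (suc n) _ = s≤s z≤n
  ltb-sound (suc m) (suc n) e = s≤s (ltb-sound m n e)
  ltb-sound zero zero ()
  ltb-sound (suc m) zero ()

  ι : Bool → ℕ
  ι true = 1
  ι false = 0

  -- Folds over the range 0 … n-1: disjunction, conjunction, ℕ-valued sum, and the
  -- position (1-based) of the last k with f k, or 0 if there is none.
  anyTo : (ℕ → Bool) → ℕ → Bool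
  anyTo f zero = false
  anyTo f (suc n) = anyTo f n ∨ f n

  allTo : (ℕ → Bool) → ℕ → Bool
  allTo f zero = true
  allTo f (suc n) = allTo f n ∧ f n

  sumTo : (ℕ → ℕ) → ℕ → ℕ
  sumTo f zero = 0
  sumTo f (suc n) = sumTo f n + f n

  lastTo : (ℕ → Bool) → ℕ → ℕ
  lastTo f zero = 0
  lastTo f (suc n) = if f n then suc n else lastTo f n

  anyTo-cong : ∀ {f g} n → (∀ k → k < n → f k ≡ g k) → anyTo f n ≡ anyTo g n
  anyTo-cong zero h = refl
  anyTo-cong (suc n) h = cong₂ _∨_ (anyTo-cong n (λ k k<n → h k (m<n⇒m<1+n k<n))) (h n ≤-refl)

  allTo-cong : ∀ {f g} n → (∀ k → k < n → f k ≡ g k) → allTo f n ≡ allTo g n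
  allTo-cong zero h = refl
  allTo-cong (suc n) h = cong₂ _∧_ (allTo-cong n (λ k k<n → h k (m<n⇒m<1+n k<n))) (h n ≤-refl)

  sumTo-cong : ∀ {f g} n → (∀ k → k < n → f k ≡ g k) → sumTo f n ≡ sumTo g n
  sumTo-cong zero h = refl
  sumTo-cong (suc n) h = cong₂ _+_ (sumTo-cong n (λ k k<n → h k (m<n⇒m<1+n k<n))) (h n ≤-refl)

  lastTo-cong : ∀ {f g} n → (∀ k → k < n → f k ≡ g k) → lastTo f n ≡ lastTo g n
  lastTo-cong zero h = refl
  lastTo-cong (suc n) h rewrite h n ≤-refl | lastTo-cong n (λ k k<n → h k (m<n⇒m<1+n k<n)) = refl

  anyTo-front : ∀ f n → anyTo f (suc n) ≡ f 0 ∨ anyTo (f ∘ suc) n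
  anyTo-front f zero = sym (∨-identityʳ (f 0))
  anyTo-front f (suc n) rewrite anyTo-front f n = ∨-assoc (f 0) (anyTo (f ∘ suc) n) (f (suc n))

  allTo-front : ∀ f n → allTo f (suc n) ≡ f 0 ∧ allTo (f ∘ suc) n
  allTo-front f zero = sym (∧-identityʳ (f 0))
  allTo-front f (suc n) rewrite allTo-front f n = ∧-assoc (f 0) (allTo (f ∘ suc) n) (f (suc n))

  sumTo-front : ∀ f n → sumTo f (suc n) ≡ f 0 + sumTo (f ∘ suc) n
  sumTo-front f zero = +-comm 0 (f 0)
  sumTo-front f (suc n) rewrite sumTo-front f n = +-assoc (f 0) (sumTo (f ∘ suc) n) (f (suc n))

  anyTo-false : ∀ n → anyTo (λ _ → false) n ≡ false
  anyTo-false zero = refl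
  anyTo-false (suc n) rewrite anyTo-false n = refl

  anyTo-∨ : ∀ f g n → anyTo (λ k → f k ∨ g k) n ≡ anyTo f n ∨ anyTo g n
  anyTo-∨ f g zero = refl
  anyTo-∨ f g (suc n) rewrite anyTo-∨ f g n = ∨-interchange (anyTo f n) (anyTo g n) (f n) (g n)

  sumTo-+ : ∀ f g n → sumTo (λ k → f k + g k) n ≡ sumTo f n + sumTo g n
  sumTo-+ f g zero = refl
  sumTo-+ f g (suc n) rewrite sumTo-+ f g n = +-interchange (sumTo f n) (sumTo g n) (f n) (g n)

  sumTo-0 : ∀ n → sumTo (λ _ → 0) n ≡ 0
  sumTo-0 zero = refl
  sumTo-0 (suc n) rewrite sumTo-0 n = refl

  any-++ : ∀ {A : Set} (p : A → Bool) xs ys → any p (xs ++ ys) ≡ any p xs ∨ any p ys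
  any-++ p [] ys = refl
  any-++ p (x ∷ xs) ys rewrite any-++ p xs ys = sym (∨-assoc (p x) (any p xs) (any p ys))

  any-concatMap : ∀ {A B : Set} (p : B → Bool) (f : A → List B) xs → any p (concatMap f xs) ≡ any (λ x → any p (f x)) xs
  any-concatMap p f [] = refl
  any-concatMap p f (x ∷ xs) = trans (any-++ p (f x) (concat (map f xs))) (cong (any p (f x) ∨_) (any-concatMap p f xs))

  any-apply : ∀ {A : Set} (p : A → Bool) (f : ℕ → A) n → any p (applyUpTo f n) ≡ anyTo (p ∘ f) n
  any-apply p f zero = refl
  any-apply p f (suc n) = trans (cong (p (f 0) ∨_) (any-apply p (f ∘ suc) n)) (sym (anyTo-front (p ∘ f) n))

  all-apply : ∀ {A : Set} (p : A → Bool) (f : ℕ → A) n → all p (applyUpTo f n) ≡ allTo (p ∘ f) n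
  all-apply p f zero = refl
  all-apply p f (suc n) = trans (cong (p (f 0) ∧_) (all-apply p (f ∘ suc) n)) (sym (allTo-front (p ∘ f) n))

  any-cong : ∀ {A : Set} {p q : A → Bool} xs → (∀ x → p x ≡ q x) → any p xs ≡ any q xs
  any-cong [] h = refl
  any-cong (x ∷ xs) h = cong₂ _∨_ (h x) (any-cong xs h)

  sumL : ∀ {A : Set} → (A → ℕ) → List A → ℕ
  sumL h xs = foldr (λ x acc → h x + acc) 0 xs

  sumL-++ : ∀ {A : Set} (h : A → ℕ) xs ys → sumL h (xs ++ ys) ≡ sumL h xs + sumL h ys
  sumL-++ h [] ys = refl
  sumL-++ h (x ∷ xs) ys rewrite sumL-++ h xs ys = sym (+-assoc (h x) (sumL h xs) (sumL h ys))

  sumL-concatMap : ∀ {A B : Set} (h : B → ℕ) (f : A → List B) xs → sumL h (concatMap f xs) ≡ sumL (λ x → sumL h (f x)) xs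
  sumL-concatMap h f [] = refl
  sumL-concatMap h f (x ∷ xs) = trans (sumL-++ h (f x) (concat (map f xs))) (cong (sumL h (f x) +_) (sumL-concatMap h f xs))

  sumL-apply : ∀ {A : Set} (h : A → ℕ) (f : ℕ → A) n → sumL h (applyUpTo f n) ≡ sumTo (h ∘ f) n
  sumL-apply h f zero = refl
  sumL-apply h f (suc n) = trans (cong (h (f 0) +_) (sumL-apply h (f ∘ suc) n)) (sym (sumTo-front (h ∘ f) n))

  sumL-cong : ∀ {A : Set} {h g : A → ℕ} xs → (∀ x → h x ≡ g x) → sumL h xs ≡ sumL g xs
  sumL-cong [] e = refl
  sumL-cong (x ∷ xs) e = cong₂ _+_ (e x) (sumL-cong xs e)

  length-sumL : ∀ {A : Set} (xs : List A) → length xs ≡ sumL (λ _ → 1) xs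
  length-sumL [] = refl
  length-sumL (x ∷ xs) = cong suc (length-sumL xs)

  filter-sumL : ∀ {A : Set} (q : A → Bool) (xs : List A) → length (filter (λ a → T? (q a)) xs) ≡ sumL (λ a → ι (q a)) xs
  filter-sumL q [] = refl
  filter-sumL q (x ∷ xs) with q x
  ... | true = cong suc (filter-sumL q xs)
  ... | false = filter-sumL q xs

  sumTo-single : ∀ {f : ℕ → ℕ} n a → a < n → (∀ k → k < n → k ≢ a → f k ≡ 0) → sumTo f n ≡ f a
  sumTo-single {f} (suc n) a a<sn h with a ≟ n
  ... | yes refl = cong (_+ f a) (trans (sumTo-cong a (λ k k<a → h k (m<n⇒m<1+n k<a) (λ e → <-irrefl e k<a))) (sumTo-0 a))
  ... | no a≢n = trans (cong₂ _+_ (sumTo-single n a (≤∧≢⇒< (≤-pred a<sn) a≢n) (λ k k<n → h k (m<n⇒m<1+n k<n))) (h n ≤-refl (λ e → a≢n (sym e)))) (+-identityʳ (f a))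

  anyTo-single : ∀ {f : ℕ → Bool} n a → a < n → (∀ k → k < n → k ≢ a → f k ≡ false) → anyTo f n ≡ f a
  anyTo-single {f} (suc n) a a<sn h with a ≟ n
  ... | yes refl = cong (_∨ f a) (trans (anyTo-cong a (λ k k<a → h k (m<n⇒m<1+n k<a) (λ e → <-irrefl e k<a))) (anyTo-false a))
  ... | no a≢n = trans (cong₂ _∨_ (anyTo-single n a (≤∧≢⇒< (≤-pred a<sn) a≢n) (λ k k<n → h k (m<n⇒m<1+n k<n))) (h n ≤-refl (λ e → a≢n (sym e)))) (∨-identityʳ (f a))

  sumTo-mono : ∀ {f g : ℕ → ℕ} n → (∀ k → k < n → f k ≤ g k) → sumTo f n ≤ sumTo g n
  sumTo-mono zero h = z≤n
  sumTo-mono (suc n) h = +-mono-≤ (sumTo-mono n (λ k k<n → h k (m<n⇒m<1+n k<n))) (h n ≤-refl)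


module IntSums where

  open import Data.Nat as ℕ using (ℕ; zero; suc; _≡ᵇ_)
  import Data.Nat.Properties as ℕP
  open import Data.Integer using (ℤ; +_; _+_; _*_; 0ℤ; 1ℤ)
  open import Data.Bool using (if_then_else_)
  open import Data.Integer.Properties
  open import Data.Integer.Tactic.RingSolver
  open import Relation.Binary.PropositionalEquality
  open import Function using (_∘_)
  open import Relation.Nullary using (yes; no)

  Σℤ : (ℕ → ℤ) → ℕ → ℤ
  Σℤ f zero = 0ℤ
  Σℤ f (suc n) = Σℤ f n + f n

  Σℤ-cong : ∀ {f g : ℕ → ℤ} n → (∀ k → k ℕ.< n → f k ≡ g k) → Σℤ f n ≡ Σℤ g n
  Σℤ-cong zero h = refl
  Σℤ-cong (suc n) h = cong₂ _+_ (Σℤ-cong n (λ k k<n → h k (ℕP.m<n⇒m<1+n k<n))) (h n ℕP.≤-refl)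

  Σℤ-ext : ∀ {f g : ℕ → ℤ} n → (∀ k → f k ≡ g k) → Σℤ f n ≡ Σℤ g n
  Σℤ-ext n h = Σℤ-cong n (λ k _ → h k)

  Σℤ-+ : ∀ (f g : ℕ → ℤ) n → Σℤ (λ k → f k + g k) n ≡ Σℤ f n + Σℤ g n
  Σℤ-+ f g zero = refl
  Σℤ-+ f g (suc n) rewrite Σℤ-+ f g n = algebra (Σℤ f n) (Σℤ g n) (f n) (g n)
    where algebra : ∀ a b c d → a + b + (c + d) ≡ a + c + (b + d)
          algebra = solve-∀

  Σℤ-* : ∀ (c : ℤ) (f : ℕ → ℤ) n → Σℤ (λ k → c * f k) n ≡ c * Σℤ f n
  Σℤ-* c f zero = sym (*-zeroʳ c)
  Σℤ-* c f (suc n) rewrite Σℤ-* c f n = sym (*-distribˡ-+ c (Σℤ f n) (f n))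

  Σℤ-0 : ∀ n → Σℤ (λ _ → 0ℤ) n ≡ 0ℤ
  Σℤ-0 zero = refl
  Σℤ-0 (suc n) rewrite Σℤ-0 n = refl

  Σℤ-zero : ∀ {f : ℕ → ℤ} n → (∀ k → k ℕ.< n → f k ≡ 0ℤ) → Σℤ f n ≡ 0ℤ
  Σℤ-zero {f} n h = trans (Σℤ-cong n h) (Σℤ-0 n)

  Σℤ-front : ∀ (f : ℕ → ℤ) n → Σℤ f (suc n) ≡ f 0 + Σℤ (f ∘ suc) n
  Σℤ-front f zero = +-comm 0ℤ (f 0)
  Σℤ-front f (suc n) rewrite Σℤ-front f n = +-assoc (f 0) (Σℤ (f ∘ suc) n) (f (suc n))

  Σℤ-single : ∀ {f : ℕ → ℤ} n a → a ℕ.< n → (∀ k → k ℕ.< n → k ≢ a → f k ≡ 0ℤ) → Σℤ f n ≡ f a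
  Σℤ-single {f} (suc n) a a<sn h with a ℕ.≟ n
  ... | yes refl = trans (cong (_+ f n) (Σℤ-zero n (λ k k<n → h k (ℕP.m<n⇒m<1+n k<n) (λ { refl → ℕP.<-irrefl refl k<n })))) (+-identityˡ (f n))
  ... | no a≢n = trans (cong₂ _+_ (Σℤ-single n a (ℕP.≤∧≢⇒< (ℕP.≤-pred a<sn) a≢n) (λ k k<n → h k (ℕP.m<n⇒m<1+n k<n))) (h n ℕP.≤-refl (λ e → a≢n (sym e)))) (+-identityʳ (f a))

  Σℤ-const : ∀ (x : ℤ) k → Σℤ (λ _ → x) k ≡ + k * x
  Σℤ-const x zero = sym (*-zeroˡ x)
  Σℤ-const x (suc k) rewrite Σℤ-const x k = sym (trans (*-distribʳ-+ x (+ 1) (+ k)) (trans (cong (_+ (+ k * x)) (*-identityˡ x)) (+-comm x (+ k * x))))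

  unitAt0 : ℕ → ℤ
  unitAt0 e = if e ≡ᵇ 0 then 1ℤ else 0ℤ

  iter : ∀ {A : Set} → (A → A) → ℕ → A → A
  iter f zero a = a
  iter f (suc k) a = iter f k (f a)

  iter-suc : ∀ {A : Set} (f : A → A) n a → iter f (suc n) a ≡ f (iter f n a)
  iter-suc f zero a = refl
  iter-suc f (suc n) a = iter-suc f n (f a)


module Binomial where

  open import Data.Nat
  open import Data.Nat.Properties
  open import Data.Nat.Combinatorics using (_C_; nCk≡nC[n∸k]; nCn≡1; nCk+nC[k+1]≡[n+1]C[k+1])
  open import Data.Nat.Combinatorics.Specification using (k>n⇒nCk≡0)
  open import Data.Nat.DivMod using (_/_; m*n/n≡m)
  open import Data.Nat.Tactic.RingSolver
  open import Relation.Binary.PropositionalEquality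

  bin : ℕ → ℕ → ℕ
  bin zero zero = 1
  bin zero (suc k) = 0
  bin (suc n) zero = 1
  bin (suc n) (suc k) = bin n k + bin n (suc k)

  bin≡C : ∀ n k → bin n k ≡ n C k
  bin≡C zero zero = refl
  bin≡C zero (suc k) = sym (k>n⇒nCk≡0 (s≤s (z≤n {k})))
  bin≡C (suc n) zero = sym (trans (nCk≡nC[n∸k] {k = 0} {n = suc n} z≤n) (nCn≡1 (suc n)))
  bin≡C (suc n) (suc k) = trans (cong₂ _+_ (bin≡C n k) (bin≡C n (suc k))) (nCk+nC[k+1]≡[n+1]C[k+1] n k)

  bin-over : ∀ n k → n < k → bin n k ≡ 0
  bin-over zero (suc k) _ = refl
  bin-over (suc n) (suc k) (s≤s n<k) rewrite bin-over n k n<k | bin-over n (suc k) (m<n⇒m<1+n n<k) = refl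

  bin-diag : ∀ n → bin n n ≡ 1
  bin-diag zero = refl
  bin-diag (suc n) rewrite bin-diag n | bin-over n (suc n) ≤-refl = refl

  bin-0 : ∀ n → bin n 0 ≡ 1
  bin-0 zero = refl
  bin-0 (suc n) = refl

  bin-1 : ∀ n → bin n 1 ≡ n
  bin-1 zero = refl
  bin-1 (suc n) rewrite bin-1 n | bin-0 n = refl

  bin-absorb : ∀ n k → suc k * bin (suc n) (suc k) ≡ suc n * bin n k
  bin-absorb zero zero = refl
  bin-absorb zero (suc k) = *-zeroʳ (suc (suc k))
  bin-absorb (suc n) zero = trans (*-identityˡ _) (trans (bin-1 (suc (suc n))) (sym (*-identityʳ _)))
  bin-absorb (suc n) (suc k) = begin
    suc (suc k) * (bin (suc n) (suc k) + bin (suc n) (suc (suc k)))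
      ≡⟨ algebra (bin (suc n) (suc k)) (bin (suc n) (suc (suc k))) k ⟩
    suc k * bin (suc n) (suc k) + bin (suc n) (suc k) + suc (suc k) * bin (suc n) (suc (suc k))
      ≡⟨ cong₂ (λ a b → a + bin (suc n) (suc k) + b) (bin-absorb n k) (bin-absorb n (suc k)) ⟩
    suc n * bin n k + (bin n k + bin n (suc k)) + suc n * bin n (suc k)
      ≡⟨ algebra₂ n (bin n k) (bin n (suc k)) ⟩
    suc (suc n) * (bin n k + bin n (suc k)) ∎
    where
    open ≡-Reasoning
    algebra : ∀ a b k → suc (suc k) * (a + b) ≡ suc k * a + a + suc (suc k) * b
    algebra = solve-∀
    algebra₂ : ∀ n a b → suc n * a + (a + b) + suc n * b ≡ suc (suc n) * (a + b)
    algebra₂ = solve-∀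

  bin-ratio : ∀ n k → suc k * bin n (suc k) + k * bin n k ≡ n * bin n k
  bin-ratio zero zero = refl
  bin-ratio zero (suc k) = cong₂ _+_ (*-zeroʳ (suc (suc k))) (*-zeroʳ (suc k))
  bin-ratio (suc n) zero = trans (+-identityʳ _) (trans (*-identityˡ _) (trans (bin-1 (suc n)) (sym (*-identityʳ _))))
  bin-ratio (suc n) (suc k) = trans (cong₂ _+_ (bin-absorb n (suc k)) (bin-absorb n k)) (algebra (suc n) (bin n (suc k)) (bin n k))
    where algebra : ∀ a x y → a * x + a * y ≡ a * (y + x)
          algebra = solve-∀

  bin-sym : ∀ a b → bin (a + b) a ≡ bin (a + b) b
  bin-sym zero b = trans (bin-0 b) (sym (bin-diag b))
  bin-sym (suc a) zero rewrite +-identityʳ a = trans (bin-diag (suc a)) (sym (bin-0 (suc a)))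
  bin-sym (suc a) (suc b) = begin
    bin (a + suc b) a + bin (a + suc b) (suc a)
      ≡⟨ cong₂ _+_ (bin-sym a (suc b)) (cong (λ z → bin z (suc a)) (+-suc a b)) ⟩
    bin (a + suc b) (suc b) + bin (suc a + b) (suc a)
      ≡⟨ cong (bin (a + suc b) (suc b) +_) (bin-sym (suc a) b) ⟩
    bin (a + suc b) (suc b) + bin (suc a + b) b
      ≡⟨ cong (λ z → bin (a + suc b) (suc b) + bin z b) (sym (+-suc a b)) ⟩
    bin (a + suc b) (suc b) + bin (a + suc b) b
      ≡⟨ +-comm (bin (a + suc b) (suc b)) (bin (a + suc b) b) ⟩
    bin (a + suc b) b + bin (a + suc b) (suc b) ∎
    where open ≡-Reasoning

  -- Ballot numbers: ballot k e is the number of walks from height e to 0 with k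
  -- up-steps and k+e down-steps that never go below 0 (see BallotWalk);
  -- ballot k 0 is the Catalan number Cₖ.
  ballot : ℕ → ℕ → ℕ
  ballot zero e = 1
  ballot (suc k) zero = ballot k 1
  ballot (suc k) (suc e) = ballot k (suc (suc e)) + ballot (suc k) e

  binPrev : ℕ → ℕ → ℕ
  binPrev N zero = 0
  binPrev N (suc k) = bin N k

  bin-suc-binPrev : ∀ N k → bin (suc N) k ≡ binPrev N k + bin N k
  bin-suc-binPrev N zero = sym (bin-0 N)
  bin-suc-binPrev N (suc k) = refl

  two-suc : ∀ k → 2 * suc k ≡ suc (1 + 2 * k)
  two-suc = solve-∀
  one-two-k : ∀ k → 1 + 2 * k ≡ k + suc k
  one-two-k = solve-∀
  shift-two : ∀ e k → suc (suc e) + 2 * k ≡ e + 2 * suc k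
  shift-two = solve-∀

  ballot-eq-step : ∀ k e → ballot k (suc (suc e)) + binPrev (suc (suc e) + 2 * k) k ≡ bin (suc (suc e) + 2 * k) k
    → ballot (suc k) e + binPrev (e + 2 * suc k) (suc k) ≡ bin (e + 2 * suc k) (suc k)
    → ballot (suc k) (suc e) + binPrev (suc e + 2 * suc k) (suc k) ≡ bin (suc e + 2 * suc k) (suc k)
  ballot-eq-step k e ih1 ih2 = begin
    ballot k (suc (suc e)) + ballot (suc k) e + bin (suc e + 2 * suc k) k
      ≡⟨ cong (ballot k (suc (suc e)) + ballot (suc k) e +_) (bin-suc-binPrev M k) ⟩
    ballot k (suc (suc e)) + ballot (suc k) e + (binPrev M k + bin M k)
      ≡⟨ algebra (ballot k (suc (suc e))) (ballot (suc k) e) (binPrev M k) (bin M k) ⟩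
    (ballot k (suc (suc e)) + binPrev M k) + (ballot (suc k) e + bin M k)
      ≡⟨ cong₂ _+_ ih1′ ih2 ⟩
    bin M k + bin M (suc k) ∎
    where
    open ≡-Reasoning
    M : ℕ
    M = e + 2 * suc k
    ih1′ : ballot k (suc (suc e)) + binPrev M k ≡ bin M k
    ih1′ = subst (λ z → ballot k (suc (suc e)) + binPrev z k ≡ bin z k) (shift-two e k) ih1
    algebra : ∀ a b c d → a + b + (c + d) ≡ (a + c) + (b + d)
    algebra = solve-∀

  -- The reflection principle in closed form: ballot k e + C(e+2k,k-1) = C(e+2k,k).
  ballot-eq : ∀ k e → ballot k e + binPrev (e + 2 * k) k ≡ bin (e + 2 * k) k
  ballot-eq zero e = sym (bin-0 (e + 2 * zero))
  ballot-eq (suc k) zero = begin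
    ballot k 1 + bin (2 * suc k) k
      ≡⟨ cong (λ z → ballot k 1 + bin z k) (two-suc k) ⟩
    ballot k 1 + bin (suc (1 + 2 * k)) k
      ≡⟨ cong (ballot k 1 +_) (bin-suc-binPrev (1 + 2 * k) k) ⟩
    ballot k 1 + (binPrev (1 + 2 * k) k + bin (1 + 2 * k) k)
      ≡⟨ sym (+-assoc (ballot k 1) _ _) ⟩
    ballot k 1 + binPrev (1 + 2 * k) k + bin (1 + 2 * k) k
      ≡⟨ cong (_+ bin (1 + 2 * k) k) (ballot-eq k 1) ⟩
    bin (1 + 2 * k) k + bin (1 + 2 * k) k
      ≡⟨ cong (bin (1 + 2 * k) k +_) bin-central-sym ⟩
    bin (1 + 2 * k) k + bin (1 + 2 * k) (suc k)
      ≡⟨ cong (λ z → bin z (suc k)) (sym (two-suc k)) ⟩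
    bin (2 * suc k) (suc k) ∎
    where
    open ≡-Reasoning
    bin-central-sym : bin (1 + 2 * k) k ≡ bin (1 + 2 * k) (suc k)
    bin-central-sym = subst (λ z → bin z k ≡ bin z (suc k)) (sym (one-two-k k)) (bin-sym k (suc k))
  ballot-eq (suc k) (suc e) = ballot-eq-step k e (ballot-eq k (suc (suc e))) (ballot-eq (suc k) e)

  -- (m+1) · ballot m 0 = C(2m,m): the reflection formula gives
  -- C(2m+2,m+1) = ballot (m+1) 0 + C(2m+2,m), and `bin-ratio` gives
  -- (m+1) C(2m+2,m+1) = (m+2) C(2m+2,m).
  central-binomial-ballot : ∀ m → bin (2 * m) m ≡ ballot m 0 * suc m
  central-binomial-ballot zero = refl
  central-binomial-ballot (suc m) = begin
      central                ≡⟨ sym (+-cancelʳ-≡ (suc m * central) (suc (suc m) * b) central scaled) ⟩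
      suc (suc m) * b        ≡⟨ *-comm (suc (suc m)) b ⟩
      b * suc (suc m)        ∎
    where
    open ≡-Reasoning
    N : ℕ
    N = 2 * suc m
    central : ℕ
    central = bin N (suc m)
    b : ℕ
    b = ballot (suc m) 0
    algebra : ∀ m x → (2 * suc m) * x ≡ suc (suc m) * x + m * x
    algebra = solve-∀
    ratio : suc m * central ≡ suc (suc m) * bin N m
    ratio = +-cancelʳ-≡ (m * bin N m) _ _ (trans (bin-ratio N m) (algebra m (bin N m)))
    scaled : suc (suc m) * b + suc m * central ≡ central + suc m * central
    scaled = begin
      suc (suc m) * b + suc m * central         ≡⟨ cong (suc (suc m) * b +_) ratio ⟩
      suc (suc m) * b + suc (suc m) * bin N m   ≡⟨ sym (*-distribˡ-+ (suc (suc m)) b (bin N m)) ⟩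
      suc (suc m) * (b + bin N m)               ≡⟨ cong (suc (suc m) *_) (ballot-eq (suc m) 0) ⟩
      suc (suc m) * central                     ∎

  catalan-ballot : ∀ m → (2 * m C m) / suc m ≡ ballot m 0
  catalan-ballot m = begin
    (2 * m C m) / suc m           ≡⟨ cong (_/ suc m) (sym (bin≡C (2 * m) m)) ⟩
    bin (2 * m) m / suc m         ≡⟨ cong (_/ suc m) (central-binomial-ballot m) ⟩
    ballot m 0 * suc m / suc m    ≡⟨ m*n/n≡m (ballot m 0) (suc m) ⟩
    ballot m 0                    ∎
    where open ≡-Reasoning


module ArcEnumeration where

  open import Data.Nat
  open import Data.Nat.Properties
  open import Data.Bool using (Bool; true; false; _∧_; _∨_; not; if_then_else_)
  open import Data.Bool.Properties using (∨-identityʳ; ∧-zeroʳ; ∧-distribˡ-∨)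
  open import Data.List using (List; []; _∷_; concatMap; length)
  open import Data.Bool.ListAction using (any)
  open import Relation.Binary.PropositionalEquality
  open import Data.Product using (_×_; _,_)
  open import Defs
  open RangeSums

  arcTo : List ℕ → ℕ → ℕ → ℕ → Bool
  arcTo s N i j = (i <ᵇ j) ∧ (lab s i ≡ᵇ lab s j) ∧ allTo (λ k → not ((i <ᵇ suc k) ∧ (suc k <ᵇ j) ∧ (lab s (suc k) ≡ᵇ lab s i))) N

  isArc≡ : ∀ s i j → isArc s i j ≡ arcTo s (length s) i j
  isArc≡ s i j = cong (λ z → (i <ᵇ j) ∧ (lab s i ≡ᵇ lab s j) ∧ z)
    (all-apply (λ k → not ((i <ᵇ k) ∧ (k <ᵇ j) ∧ (lab s k ≡ᵇ lab s i))) suc (length s))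

  sumArcs : List ℕ → ℕ → (ℕ → ℕ → ℕ) → ℕ
  sumArcs s N h = sumTo (λ i → sumTo (λ j → if arcTo s N (suc i) (suc j) then h (suc i) (suc j) else 0) N) N

  anyArc : List ℕ → ℕ → (ℕ → ℕ → Bool) → Bool
  anyArc s N g = anyTo (λ i → anyTo (λ j → arcTo s N (suc i) (suc j) ∧ g (suc i) (suc j)) N) N

  sumL-if : ∀ {A : Set} (h : A → ℕ) b (x : A) → sumL h (if b then x ∷ [] else []) ≡ (if b then h x else 0)
  sumL-if h true x = +-identityʳ (h x)
  sumL-if h false x = refl

  any-if : ∀ {A : Set} (p : A → Bool) b (x : A) → any p (if b then x ∷ [] else []) ≡ b ∧ p x
  any-if p true x = ∨-identityʳ (p x)
  any-if p false x = refl

  sumL-Arc : ∀ s (h : ℕ × ℕ → ℕ) → sumL h (Arc s) ≡ sumArcs s (length s) (λ i j → h (i , j))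
  sumL-Arc s h = begin
    sumL h (Arc s)
      ≡⟨ sumL-concatMap h F P ⟩
    sumL (λ i → sumL h (F i)) P
      ≡⟨ sumL-cong P (λ i → sumL-concatMap h (G i) P) ⟩
    sumL (λ i → sumL (λ j → sumL h (G i j)) P) P
      ≡⟨ sumL-apply _ suc (length s) ⟩
    sumTo (λ i → sumL (λ j → sumL h (G (suc i) j)) P) (length s)
      ≡⟨ sumTo-cong (length s) (λ i _ → sumL-apply _ suc (length s)) ⟩
    sumTo (λ i → sumTo (λ j → sumL h (G (suc i) (suc j))) (length s)) (length s)
      ≡⟨ sumTo-cong (length s) (λ i _ → sumTo-cong (length s) (λ j _ →
           trans (sumL-if h (isArc s (suc i) (suc j)) (suc i , suc j))
                 (cong (λ b → if b then h (suc i , suc j) else 0) (isArc≡ s (suc i) (suc j))))) ⟩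
    sumArcs s (length s) (λ i j → h (i , j)) ∎
    where
    open ≡-Reasoning
    P : List ℕ
    P = positions s
    G : ℕ → ℕ → List (ℕ × ℕ)
    G = λ i j → if isArc s i j then (i , j) ∷ [] else []
    F : ℕ → List (ℕ × ℕ)
    F = λ i → concatMap (G i) P

  any-Arc : ∀ s (p : ℕ × ℕ → Bool) → any p (Arc s) ≡ anyArc s (length s) (λ i j → p (i , j))
  any-Arc s p = begin
    any p (Arc s)
      ≡⟨ any-concatMap p F P ⟩
    any (λ i → any p (F i)) P
      ≡⟨ any-cong P (λ i → any-concatMap p (G i) P) ⟩
    any (λ i → any (λ j → any p (G i j)) P) P
      ≡⟨ any-apply _ suc (length s) ⟩
    anyTo (λ i → any (λ j → any p (G (suc i) j)) P) (length s)
      ≡⟨ anyTo-cong (length s) (λ i _ → any-apply _ suc (length s)) ⟩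
    anyTo (λ i → anyTo (λ j → any p (G (suc i) (suc j))) (length s)) (length s)
      ≡⟨ anyTo-cong (length s) (λ i _ → anyTo-cong (length s) (λ j _ →
           trans (any-if p (isArc s (suc i) (suc j)) (suc i , suc j))
                 (cong (λ b → b ∧ p (suc i , suc j)) (isArc≡ s (suc i) (suc j))))) ⟩
    anyArc s (length s) (λ i j → p (i , j)) ∎
    where
    open ≡-Reasoning
    P : List ℕ
    P = positions s
    G : ℕ → ℕ → List (ℕ × ℕ)
    G = λ i j → if isArc s i j then (i , j) ∷ [] else []
    F : ℕ → List (ℕ × ℕ)
    F = λ i → concatMap (G i) P

  nArc≡ : ∀ s → nArc s ≡ sumArcs s (length s) (λ _ _ → 1)
  nArc≡ s = trans (length-sumL (Arc s)) (sumL-Arc s (λ _ → 1))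

  nCov≡ : ∀ s → nCov s ≡ sumArcs s (length s) (λ i j → ι (j ≡ᵇ suc i))
  nCov≡ s = trans (filter-sumL isCov (Arc s)) (sumL-Arc s (λ a → ι (isCov a)))

  hasCrossing : List ℕ → ℕ → Bool
  hasCrossing s N = anyArc s N (λ i j → anyArc s N (λ i' j' → crosses (i , j) (i' , j')))

  isNC≡ : ∀ s → isNC s ≡ not (hasCrossing s (length s))
  isNC≡ s = cong not (trans (any-cong (Arc s) (λ a → any-Arc s (crosses a)))
                            (any-Arc s (λ a → anyArc s (length s) (λ i' j' → crosses a (i' , j')))))

  anyArc-cong : ∀ s N {g g' : ℕ → ℕ → Bool} → (∀ i j → i < N → j < N → g (suc i) (suc j) ≡ g' (suc i) (suc j)) → anyArc s N g ≡ anyArc s N g'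
  anyArc-cong s N h = anyTo-cong N (λ i i<N → anyTo-cong N (λ j j<N → cong (arcTo s N (suc i) (suc j) ∧_) (h i j i<N j<N)))

  anyArc-∨ : ∀ s N (g g' : ℕ → ℕ → Bool) → anyArc s N (λ i j → g i j ∨ g' i j) ≡ anyArc s N g ∨ anyArc s N g'
  anyArc-∨ s N g g' = trans (anyTo-cong N (λ i _ → trans (anyTo-cong N (λ j _ → ∧-distribˡ-∨ (arcTo s N (suc i) (suc j)) _ _)) (anyTo-∨ _ _ N))) (anyTo-∨ _ _ N)

  anyArc-∧ : ∀ s N b (g : ℕ → ℕ → Bool) → anyArc s N (λ i j → b ∧ g i j) ≡ b ∧ anyArc s N g
  anyArc-∧ s N true g = refl
  anyArc-∧ s N false g = trans (anyTo-cong N (λ i _ → trans (anyTo-cong N (λ j _ → ∧-zeroʳ (arcTo s N (suc i) (suc j)))) (anyTo-false N))) (anyTo-false N)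

  anyArc-false : ∀ s N → anyArc s N (λ _ _ → false) ≡ false
  anyArc-false s N = anyArc-∧ s N false (λ _ _ → true)

  sumArcs-mono : ∀ s N {h h' : ℕ → ℕ → ℕ} → (∀ i j → h i j ≤ h' i j) → sumArcs s N h ≤ sumArcs s N h'
  sumArcs-mono s N {h} {h'} le = sumTo-mono N (λ i _ → sumTo-mono N (λ j _ → go (suc i) (suc j) (arcTo s N (suc i) (suc j))))
    where go : ∀ i j b → (if b then h i j else 0) ≤ (if b then h' i j else 0)
          go i j true = le i j
          go i j false = z≤n


module AppendArcs where

  open import Data.Nat
  open import Data.Nat.Properties
  open import Data.Bool using (Bool; true; false; _∧_; _∨_; not; if_then_else_)
  open import Data.Bool.Properties using (∨-identityʳ; ∧-identityʳ; ∧-zeroʳ; ∨-comm)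
  open import Data.List using (List; []; _∷_; _++_; length)
  open import Relation.Binary.PropositionalEquality
  open import Relation.Nullary using (yes; no)
  open import Defs
  open RangeSums
  open ArcEnumeration

  length-snoc : ∀ (s : List ℕ) c → length (s ++ c ∷ []) ≡ suc (length s)
  length-snoc [] c = refl
  length-snoc (a ∷ s) c = cong suc (length-snoc s c)

  lab-old : ∀ s c k → k ≤ length s → lab (s ++ c ∷ []) k ≡ lab s k
  lab-old [] c zero _ = refl
  lab-old (a ∷ s) c zero _ = refl
  lab-old (a ∷ s) c (suc zero) _ = refl
  lab-old (a ∷ s) c (suc (suc k)) (s≤s p) = lab-old s c (suc k) p

  lab-new : ∀ s c → lab (s ++ c ∷ []) (suc (length s)) ≡ c
  lab-new [] c = refl
  lab-new (a ∷ s) c = lab-new s c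

  hasLabel : List ℕ → ℕ → ℕ → Bool
  hasLabel s b k = lab s (suc k) ≡ᵇ b

  occurs : List ℕ → ℕ → Bool
  occurs s b = anyTo (hasLabel s b) (length s)

  lastPos : List ℕ → ℕ → ℕ
  lastPos s b = lastTo (hasLabel s b) (length s)

  isLastHit : (ℕ → Bool) → ℕ → ℕ → Bool
  isLastHit p i N = p i ∧ allTo (λ k → not ((i <ᵇ k) ∧ p k)) N

  lastTo-≤ : ∀ p n → lastTo p n ≤ n
  lastTo-≤ p zero = z≤n
  lastTo-≤ p (suc n) with p n
  ... | true = ≤-refl
  ... | false = m≤n⇒m≤1+n (lastTo-≤ p n)

  lastTo-pos : ∀ p n → anyTo p n ≡ true → 1 ≤ lastTo p n
  lastTo-pos p (suc n) e with p n | e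
  ... | true | _ = s≤s z≤n
  ... | false | e' = lastTo-pos p n (trans (sym (∨-identityʳ _)) e')

  allTo-true : ∀ m → allTo (λ _ → true) m ≡ true
  allTo-true zero = refl
  allTo-true (suc m) rewrite allTo-true m = refl

  isLastHit-last : ∀ p n → isLastHit p n (suc n) ≡ anyTo p (suc n) ∧ (suc n ≡ᵇ lastTo p (suc n))
  isLastHit-last p n = trans lastHit-reduces (lastHit-cases (p n) refl)
    where
    nothing-later : allTo (λ k → not ((n <ᵇ k) ∧ p k)) n ≡ true
    nothing-later = trans (allTo-cong n (λ k k<n → cong (λ z → not (z ∧ p k)) (ltb-false n k (<⇒≤ k<n)))) (allTo-true n)
    lastHit-reduces : isLastHit p n (suc n) ≡ p n
    lastHit-reduces rewrite nothing-later | ltb-false n n ≤-refl = ∧-identityʳ (p n)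
    lastHit-cases : ∀ b → p n ≡ b → b ≡ (anyTo p n ∨ p n) ∧ (suc n ≡ᵇ (if p n then suc n else lastTo p n))
    lastHit-cases true e rewrite e | ∨-comm (anyTo p n) true = sym (eqb-refl n)
    lastHit-cases false e rewrite e | eqb-≢ (suc n) (lastTo p n) (λ q → <-irrefl (sym q) (s≤s (lastTo-≤ p n))) = sym (∧-zeroʳ _)

  isLastHit-char : ∀ p i n → i < n → isLastHit p i n ≡ anyTo p n ∧ (suc i ≡ᵇ lastTo p n)
  isLastHit-char p i (suc n) i<sn with i ≟ n
  ... | yes refl = isLastHit-last p i
  ... | no i≢n = go (p n) refl
    where
    i<n : i < n
    i<n = ≤∧≢⇒< (≤-pred i<sn) i≢n
    go : ∀ b → p n ≡ b → isLastHit p i (suc n) ≡ anyTo p (suc n) ∧ (suc i ≡ᵇ lastTo p (suc n))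
    go true e rewrite e | ltb-true i n i<n | ∨-comm (anyTo p n) true | eqb-≢ i n i≢n = trans (cong (p i ∧_) (∧-zeroʳ _)) (∧-zeroʳ (p i))
    go false e rewrite e | ltb-true i n i<n | ∨-identityʳ (anyTo p n) =
      trans (cong (p i ∧_) (∧-identityʳ _)) (isLastHit-char p i n i<n)

  module _ (s : List ℕ) (c : ℕ) where
    private
      s' : List ℕ
      s' = s ++ c ∷ []
      n : ℕ
      n = length s

    arcTo-old : ∀ i j → i < n → j < n → arcTo s' (suc n) (suc i) (suc j) ≡ arcTo s n (suc i) (suc j)
    arcTo-old i j i<n j<n
      rewrite lab-old s c (suc i) i<n | lab-old s c (suc j) j<n | ltb-false n j (<⇒≤ j<n)
            | ∧-zeroʳ (suc i <ᵇ suc n) | ∧-identityʳ (allTo (λ k → not ((suc i <ᵇ suc k) ∧ (suc k <ᵇ suc j) ∧ (lab s' (suc k) ≡ᵇ lab s (suc i)))) n)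
      = cong (λ z → (suc i <ᵇ suc j) ∧ (lab s (suc i) ≡ᵇ lab s (suc j)) ∧ z)
          (allTo-cong n (λ k k<n → cong (λ z → not ((i <ᵇ k) ∧ (k <ᵇ j) ∧ (z ≡ᵇ lab s (suc i)))) (lab-old s c (suc k) k<n)))

    arcTo-new : ∀ i → i < n → arcTo s' (suc n) (suc i) (suc n) ≡ isLastHit (hasLabel s c) i n
    arcTo-new i i<n
      rewrite lab-old s c (suc i) i<n | lab-new s c | ltb-true i n i<n | ltb-false n n ≤-refl
      = go (lab s (suc i) ≡ᵇ c) refl
      where
      go : ∀ b → (lab s (suc i) ≡ᵇ c) ≡ b →
        (lab s (suc i) ≡ᵇ c) ∧ (allTo (λ k → not ((i <ᵇ k) ∧ (k <ᵇ n) ∧ (lab s' (suc k) ≡ᵇ lab s (suc i)))) n ∧ true)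
          ≡ isLastHit (hasLabel s c) i n
      go false e rewrite e = refl
      go true e = trans (cong (λ z → z ∧ (allTo (λ k → not ((i <ᵇ k) ∧ (k <ᵇ n) ∧ (lab s' (suc k) ≡ᵇ lab s (suc i)))) n ∧ true)) e)
         (trans (∧-identityʳ _) (trans (allTo-cong n pointwise) (cong (_∧ allTo (λ k → not ((i <ᵇ k) ∧ (lab s (suc k) ≡ᵇ c))) n) (sym e))))
        where
        L : lab s (suc i) ≡ c
        L = eqb-≡ _ _ e
        pointwise : ∀ k → k < n → not ((i <ᵇ k) ∧ (k <ᵇ n) ∧ (lab s' (suc k) ≡ᵇ lab s (suc i))) ≡ not ((i <ᵇ k) ∧ (lab s (suc k) ≡ᵇ c))
        pointwise k k<n rewrite ltb-true k n k<n | lab-old s c (suc k) k<n | L = refl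

    arcTo-top : ∀ N j → j ≤ n → arcTo s' N (suc n) (suc j) ≡ false
    arcTo-top N j j≤n rewrite ltb-false n j j≤n = refl

    sumTo-lastHit : ∀ (h : ℕ → ℕ) → sumTo (λ i → if isLastHit (hasLabel s c) i n then h (suc i) else 0) n ≡ (if occurs s c then h (lastPos s c) else 0)
    sumTo-lastHit h = trans (sumTo-cong n (λ i i<n → cong (λ b → if b then h (suc i) else 0) (isLastHit-char (hasLabel s c) i n i<n))) (go (occurs s c) refl)
      where
      go : ∀ b → occurs s c ≡ b → sumTo (λ i → if occurs s c ∧ (suc i ≡ᵇ lastPos s c) then h (suc i) else 0) n ≡ (if b then h (lastPos s c) else 0)
      go false e rewrite e = sumTo-0 n
      go true e rewrite e with lastPos s c | lastTo-pos (hasLabel s c) n e | lastTo-≤ (hasLabel s c) n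
      ... | suc a | _ | sa≤n = trans (sumTo-single n a sa≤n (λ k k<n k≢a → cong (λ b → if b then h (suc k) else 0) (eqb-≢ k a k≢a))) (cong (λ b → if b then h (suc a) else 0) (eqb-refl a))

    anyTo-lastHit : ∀ (g : ℕ → Bool) → anyTo (λ i → isLastHit (hasLabel s c) i n ∧ g (suc i)) n ≡ occurs s c ∧ g (lastPos s c)
    anyTo-lastHit g = trans (anyTo-cong n (λ i i<n → cong (_∧ g (suc i)) (isLastHit-char (hasLabel s c) i n i<n))) (go (occurs s c) refl)
      where
      go : ∀ b → occurs s c ≡ b → anyTo (λ i → (occurs s c ∧ (suc i ≡ᵇ lastPos s c)) ∧ g (suc i)) n ≡ b ∧ g (lastPos s c)
      go false e rewrite e = anyTo-false n
      go true e rewrite e with lastPos s c | lastTo-pos (hasLabel s c) n e | lastTo-≤ (hasLabel s c) n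
      ... | suc a | _ | sa≤n = trans (anyTo-single n a sa≤n (λ k k<n k≢a → cong (_∧ g (suc k)) (eqb-≢ k a k≢a))) (cong (_∧ g (suc a)) (eqb-refl a))

    sumArcs-snoc : ∀ h → sumArcs s' (suc n) h ≡ sumArcs s n h + (if occurs s c then h (lastPos s c) (suc n) else 0)
    sumArcs-snoc h = begin
      sumTo R n + R n
        ≡⟨ cong (sumTo R n +_) (trans (sumTo-cong (suc n) (λ j j<sn → cong (λ b → if b then h (suc n) (suc j) else 0) (arcTo-top (suc n) j (≤-pred j<sn)))) (sumTo-0 (suc n))) ⟩
      sumTo R n + 0
        ≡⟨ +-identityʳ _ ⟩
      sumTo R n
        ≡⟨ sumTo-cong n (λ i i<n → cong₂ _+_
             (sumTo-cong n (λ j j<n → cong (λ b → if b then h (suc i) (suc j) else 0) (arcTo-old i j i<n j<n)))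
             (cong (λ b → if b then h (suc i) (suc n) else 0) (arcTo-new i i<n))) ⟩
      sumTo (λ i → sumTo (λ j → if arcTo s n (suc i) (suc j) then h (suc i) (suc j) else 0) n + (if isLastHit (hasLabel s c) i n then h (suc i) (suc n) else 0)) n
        ≡⟨ sumTo-+ _ _ n ⟩
      sumArcs s n h + sumTo (λ i → if isLastHit (hasLabel s c) i n then h (suc i) (suc n) else 0) n
        ≡⟨ cong (sumArcs s n h +_) (sumTo-lastHit (λ i → h i (suc n))) ⟩
      sumArcs s n h + (if occurs s c then h (lastPos s c) (suc n) else 0) ∎
      where
      open ≡-Reasoning
      R : ℕ → ℕ
      R = λ i → sumTo (λ j → if arcTo s' (suc n) (suc i) (suc j) then h (suc i) (suc j) else 0) (suc n)

    anyArc-snoc : ∀ g → anyArc s' (suc n) g ≡ anyArc s n g ∨ (occurs s c ∧ g (lastPos s c) (suc n))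
    anyArc-snoc g = begin
      anyTo R n ∨ R n
        ≡⟨ cong (anyTo R n ∨_) (trans (anyTo-cong (suc n) (λ j j<sn → cong (_∧ g (suc n) (suc j)) (arcTo-top (suc n) j (≤-pred j<sn)))) (anyTo-false (suc n))) ⟩
      anyTo R n ∨ false
        ≡⟨ ∨-identityʳ _ ⟩
      anyTo R n
        ≡⟨ anyTo-cong n (λ i i<n → cong₂ _∨_
             (anyTo-cong n (λ j j<n → cong (_∧ g (suc i) (suc j)) (arcTo-old i j i<n j<n)))
             (cong (_∧ g (suc i) (suc n)) (arcTo-new i i<n))) ⟩
      anyTo (λ i → anyTo (λ j → arcTo s n (suc i) (suc j) ∧ g (suc i) (suc j)) n ∨ (isLastHit (hasLabel s c) i n ∧ g (suc i) (suc n))) n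
        ≡⟨ anyTo-∨ _ _ n ⟩
      anyArc s n g ∨ anyTo (λ i → isLastHit (hasLabel s c) i n ∧ g (suc i) (suc n)) n
        ≡⟨ cong (anyArc s n g ∨_) (anyTo-lastHit (λ i → g i (suc n))) ⟩
      anyArc s n g ∨ (occurs s c ∧ g (lastPos s c) (suc n)) ∎
      where
      open ≡-Reasoning
      R : ℕ → Bool
      R = λ i → anyTo (λ j → arcTo s' (suc n) (suc i) (suc j) ∧ g (suc i) (suc j)) (suc n)


module AppendStatistics where

  open import Data.Nat
  open import Data.Nat.Properties
  open import Data.Bool using (Bool; true; false; _∧_; _∨_; not; if_then_else_)
  open import Data.Bool.Properties using (∨-identityʳ; ∧-identityʳ; ∧-zeroʳ)
  open import Data.List using (List; []; _∷_; _++_; length)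
  open import Relation.Binary.PropositionalEquality
  open import Data.Product using (_,_)
  open import Defs
  open RangeSums
  open ArcEnumeration
  open AppendArcs

  ι-if : ∀ b → (if b then 1 else 0) ≡ ι b
  ι-if true = refl
  ι-if false = refl

  ι≤1 : ∀ b → ι b ≤ 1
  ι≤1 true = ≤-refl
  ι≤1 false = z≤n

  coveredLast : List ℕ → ℕ → Bool
  coveredLast s b = anyArc s (length s) (λ i j → (i <ᵇ lastPos s b) ∧ (lastPos s b <ᵇ j))

  -- Appending b keeps s noncrossing: b is new, or its last position is uncovered.
  canJoin : List ℕ → ℕ → Bool
  canJoin s b = not (occurs s b ∧ coveredLast s b)

  blocksFrom : List ℕ → ℕ → ℕ
  blocksFrom [] m = m
  blocksFrom (x ∷ t) m = blocksFrom t (if x <ᵇ m then m else suc x)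

  blocksFrom-step : ∀ a x t → nBlocks (a ∷ x ∷ t) ≡ (if x <ᵇ suc a then nBlocks (a ∷ t) else nBlocks (x ∷ t))
  blocksFrom-step a x t = go (x <ᵇ suc a) refl
    where
    go : ∀ b → (x <ᵇ suc a) ≡ b → nBlocks (a ∷ x ∷ t) ≡ (if b then nBlocks (a ∷ t) else nBlocks (x ∷ t))
    go true e rewrite e = refl
    go false e rewrite e = refl

  blocksFrom-cons : ∀ t a → nBlocks (a ∷ t) ≡ blocksFrom t (suc a)
  blocksFrom-cons [] a = refl
  blocksFrom-cons (x ∷ t) a = trans (blocksFrom-step a x t) (go (x <ᵇ suc a) refl)
    where
    go : ∀ b → (x <ᵇ suc a) ≡ b → (if b then nBlocks (a ∷ t) else nBlocks (x ∷ t)) ≡ blocksFrom (x ∷ t) (suc a)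
    go true e rewrite e = blocksFrom-cons t a
    go false e rewrite e = blocksFrom-cons t x

  nBlocks≡ : ∀ s → nBlocks s ≡ blocksFrom s 0
  nBlocks≡ [] = refl
  nBlocks≡ (a ∷ t) = blocksFrom-cons t a

  blocksFrom-snoc : ∀ s c m → blocksFrom (s ++ c ∷ []) m ≡ (if c <ᵇ blocksFrom s m then blocksFrom s m else suc c)
  blocksFrom-snoc [] c m = refl
  blocksFrom-snoc (x ∷ s) c m = blocksFrom-snoc s c _

  module _ (s : List ℕ) (c : ℕ) where
    private
      s' : List ℕ
      s' = s ++ c ∷ []
      n : ℕ
      n = length s

    hasLabel-snoc : ∀ b k → k < n → hasLabel s' b k ≡ hasLabel s b k
    hasLabel-snoc b k k<n = cong (_≡ᵇ b) (lab-old s c (suc k) k<n)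

    occurs-snoc : ∀ b → occurs s' b ≡ occurs s b ∨ (c ≡ᵇ b)
    occurs-snoc b = trans (cong (anyTo (hasLabel s' b)) (length-snoc s c))
       (cong₂ _∨_ (anyTo-cong n (hasLabel-snoc b)) (cong (_≡ᵇ b) (lab-new s c)))

    lastPos-snoc : ∀ b → lastPos s' b ≡ (if c ≡ᵇ b then suc n else lastPos s b)
    lastPos-snoc b = trans (cong (lastTo (hasLabel s' b)) (length-snoc s c))
       (trans (cong (λ z → if z then suc n else lastTo (hasLabel s' b) n) (cong (_≡ᵇ b) (lab-new s c)))
              (cong (λ z → if c ≡ᵇ b then suc n else z) (lastTo-cong n (hasLabel-snoc b))))

    sumArcs-append : ∀ h → sumArcs s' (length s') h ≡ sumArcs s n h + (if occurs s c then h (lastPos s c) (suc n) else 0)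
    sumArcs-append h = trans (cong (λ N → sumArcs s' N h) (length-snoc s c)) (sumArcs-snoc s c h)

    anyArc-append : ∀ g → anyArc s' (length s') g ≡ anyArc s n g ∨ (occurs s c ∧ g (lastPos s c) (suc n))
    anyArc-append g = trans (cong (λ N → anyArc s' N g) (length-snoc s c)) (anyArc-snoc s c g)

    nArc-snoc : nArc s' ≡ nArc s + ι (occurs s c)
    nArc-snoc = trans (nArc≡ s') (trans (sumArcs-append (λ _ _ → 1)) (cong₂ _+_ (sym (nArc≡ s)) (ι-if (occurs s c))))

    nCov-snoc : nCov s' ≡ nCov s + ι (occurs s c ∧ (n ≡ᵇ lastPos s c))
    nCov-snoc = trans (nCov≡ s') (trans (sumArcs-append (λ i j → ι (j ≡ᵇ suc i))) (cong₂ _+_ (sym (nCov≡ s)) (covering-indicator (occurs s c))))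
      where covering-indicator : ∀ b → (if b then ι (suc n ≡ᵇ suc (lastPos s c)) else 0) ≡ ι (b ∧ (n ≡ᵇ lastPos s c))
            covering-indicator true = refl
            covering-indicator false = refl

    nCov≤nArc : ∀ t → nCov t ≤ nArc t
    nCov≤nArc t = subst₂ _≤_ (sym (nCov≡ t)) (sym (nArc≡ t)) (sumArcs-mono t (length t) {λ i j → ι (j ≡ᵇ suc i)} {λ _ _ → 1} (λ i j → ι≤1 (j ≡ᵇ suc i)))

    nNonCov-snoc : nNonCov s' ≡ nNonCov s + ι (occurs s c ∧ not (n ≡ᵇ lastPos s c))
    nNonCov-snoc = begin
      nArc s' ∸ nCov s'
        ≡⟨ cong₂ _∸_ nArc-snoc nCov-snoc ⟩
      (nArc s + ι o) ∸ (nCov s + ι (o ∧ t))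
        ≡⟨ sym (∸-+-assoc (nArc s + ι o) (nCov s) (ι (o ∧ t))) ⟩
      (nArc s + ι o) ∸ nCov s ∸ ι (o ∧ t)
        ≡⟨ cong (_∸ ι (o ∧ t)) (+-∸-comm (ι o) (nCov≤nArc s)) ⟩
      (nArc s ∸ nCov s) + ι o ∸ ι (o ∧ t)
        ≡⟨ +-∸-assoc (nArc s ∸ nCov s) (indicator-≤ o t) ⟩
      (nArc s ∸ nCov s) + (ι o ∸ ι (o ∧ t))
        ≡⟨ cong ((nArc s ∸ nCov s) +_) (indicator-∸ o t) ⟩
      nNonCov s + ι (o ∧ not t) ∎
      where
      open ≡-Reasoning
      o : Bool
      o = occurs s c
      t : Bool
      t = n ≡ᵇ lastPos s c
      indicator-≤ : ∀ o t → ι (o ∧ t) ≤ ι o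
      indicator-≤ true true = ≤-refl
      indicator-≤ true false = z≤n
      indicator-≤ false t = z≤n
      indicator-∸ : ∀ o t → ι o ∸ ι (o ∧ t) ≡ ι (o ∧ not t)
      indicator-∸ true true = refl
      indicator-∸ true false = refl
      indicator-∸ false t = refl

    private
      o : Bool
      o = occurs s c
      P : ℕ
      P = lastPos s c

    crossesAppended : ℕ → ℕ → Bool
    crossesAppended i j = anyArc s n (λ i' j' → crosses (i , j) (i' , j')) ∨ (o ∧ crosses (i , j) (P , suc n))

    -- The new arc (lastPos s c, n+1) can only be crossed by an arc passing over
    -- lastPos s c; it cannot cross an old arc from the left.
    hasCrossing-snoc : hasCrossing s' (length s') ≡ (hasCrossing s n ∨ (o ∧ coveredLast s c)) ∨ false
    hasCrossing-snoc = begin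
      hasCrossing s' (length s')
        ≡⟨ anyArc-cong s' (length s') {g = λ i j → anyArc s' (length s') (λ i' j' → crosses (i , j) (i' , j'))} {g' = crossesAppended} (λ i j _ _ → anyArc-append (λ i' j' → crosses (suc i , suc j) (i' , j'))) ⟩
      anyArc s' (length s') crossesAppended
        ≡⟨ anyArc-append crossesAppended ⟩
      anyArc s n crossesAppended ∨ (o ∧ crossesAppended P (suc n))
        ≡⟨ cong₂ _∨_ old-arcs (cong (o ∧_) new-arc-uncrossed) ⟩
      (hasCrossing s n ∨ (o ∧ coveredLast s c)) ∨ (o ∧ false)
        ≡⟨ cong ((hasCrossing s n ∨ (o ∧ coveredLast s c)) ∨_) (∧-zeroʳ o) ⟩
      (hasCrossing s n ∨ (o ∧ coveredLast s c)) ∨ false ∎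
      where
      open ≡-Reasoning
      old-arcs : anyArc s n crossesAppended ≡ hasCrossing s n ∨ (o ∧ coveredLast s c)
      old-arcs = trans (anyArc-∨ s n (λ i j → anyArc s n (λ i' j' → crosses (i , j) (i' , j'))) (λ i j → o ∧ crosses (i , j) (P , suc n))) (cong (hasCrossing s n ∨_) (trans (anyArc-∧ s n o (λ i j → crosses (i , j) (P , suc n))) (cong (o ∧_)
             (anyArc-cong s n {g = λ i j → crosses (i , j) (P , suc n)} {g' = λ i j → (i <ᵇ P) ∧ (P <ᵇ j)} (λ i j i<n j<n → cong ((suc i <ᵇ P) ∧_) (trans (cong ((P <ᵇ suc j) ∧_) (ltb-true j n j<n)) (∧-identityʳ _)))))))
      new-arc-uncrossed : crossesAppended P (suc n) ≡ false
      new-arc-uncrossed = cong₂ _∨_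
        (trans (anyArc-cong s n {g = λ i' j' → crosses (P , suc n) (i' , j')} {g' = λ _ _ → false} (λ i j i<n j<n →
            trans (cong (λ z → (P <ᵇ suc i) ∧ ((i <ᵇ n) ∧ z)) (ltb-false n j (<⇒≤ j<n)))
                  (trans (cong ((P <ᵇ suc i) ∧_) (∧-zeroʳ (i <ᵇ n))) (∧-zeroʳ _))))
               (anyArc-false s n))
        (trans (cong (λ z → o ∧ (z ∧ ((P <ᵇ suc n) ∧ (suc n <ᵇ suc n)))) (ltb-false P P ≤-refl)) (∧-zeroʳ o))

    isNC-snoc : isNC s' ≡ isNC s ∧ canJoin s c
    isNC-snoc = trans (isNC≡ s') (trans (cong not hasCrossing-snoc) (trans (de-morgan (hasCrossing s n) (o ∧ coveredLast s c)) (cong (_∧ canJoin s c) (sym (isNC≡ s)))))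
      where de-morgan : ∀ a b → not ((a ∨ b) ∨ false) ≡ not a ∧ not b
            de-morgan true b = refl
            de-morgan false true = refl
            de-morgan false false = refl

    canJoin-self : canJoin s' c ≡ true
    canJoin-self = trans (cong (λ z → not (occurs s' c ∧ z)) (trans (cong (λ Q → anyArc s' (length s') (λ i j → (i <ᵇ Q) ∧ (Q <ᵇ j))) lastPos-c)
        (trans (anyArc-append (λ i j → (i <ᵇ suc n) ∧ (suc n <ᵇ j))) (trans (cong₂ _∨_ nothing-passes-end (cong (o ∧_) (trans (cong ((P <ᵇ suc n) ∧_) (ltb-false n n ≤-refl)) (∧-zeroʳ _)))) (trans (cong (false ∨_) (∧-zeroʳ o)) refl)))))
      (∧-zeroʳ-not (occurs s' c))
      where
      lastPos-c : lastPos s' c ≡ suc n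
      lastPos-c = trans (lastPos-snoc c) (cong (λ z → if z then suc n else lastPos s c) (eqb-refl c))
      nothing-passes-end : anyArc s n (λ i j → (i <ᵇ suc n) ∧ (suc n <ᵇ j)) ≡ false
      nothing-passes-end = trans (anyArc-cong s n {g = λ i j → (i <ᵇ suc n) ∧ (suc n <ᵇ j)} {g' = λ _ _ → false} (λ i j i<n j<n → trans (cong ((suc i <ᵇ suc n) ∧_) (ltb-false n j (<⇒≤ j<n))) (∧-zeroʳ _))) (anyArc-false s n)
      ∧-zeroʳ-not : ∀ a → not (a ∧ false) ≡ true
      ∧-zeroʳ-not true = refl
      ∧-zeroʳ-not false = refl

    canJoin-other : ∀ b → b ≢ c → canJoin s' b ≡ not (occurs s b ∧ (coveredLast s b ∨ (occurs s c ∧ (lastPos s c <ᵇ lastPos s b))))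
    canJoin-other b b≢c = cong₂ (λ x y → not (x ∧ y)) occb
      (trans (cong (λ Q → anyArc s' (length s') (λ i j → (i <ᵇ Q) ∧ (Q <ᵇ j))) lpb)
        (trans (anyArc-append (λ i j → (i <ᵇ lastPos s b) ∧ (lastPos s b <ᵇ j))) (cong (coveredLast s b ∨_) (cong (o ∧_) (trans (cong ((P <ᵇ lastPos s b) ∧_) (ltb-true (lastPos s b) (suc n) (s≤s (lastTo-≤ (hasLabel s b) n)))) (∧-identityʳ _))))))
      where
      cb : (c ≡ᵇ b) ≡ false
      cb = eqb-≢ c b (λ e → b≢c (sym e))
      occb : occurs s' b ≡ occurs s b
      occb = trans (occurs-snoc b) (trans (cong (occurs s b ∨_) cb) (∨-identityʳ _))
      lpb : lastPos s' b ≡ lastPos s b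
      lpb = trans (lastPos-snoc b) (cong (λ z → if z then suc n else lastPos s b) cb)

  bs-cons : ∀ x xs b → blockSize (x ∷ xs) b ≡ ι (x ≡ᵇ b) + blockSize xs b
  bs-cons x xs b = go (x ≡ᵇ b) refl
    where
    go : ∀ t → (x ≡ᵇ b) ≡ t → blockSize (x ∷ xs) b ≡ ι t + blockSize xs b
    go true e rewrite e = refl
    go false e rewrite e = refl

  bs-snoc : ∀ s c b → blockSize (s ++ c ∷ []) b ≡ blockSize s b + ι (c ≡ᵇ b)
  bs-snoc [] c b = trans (bs-cons c [] b) (+-comm (ι (c ≡ᵇ b)) 0)
  bs-snoc (x ∷ s) c b = trans (bs-cons x (s ++ c ∷ []) b) (trans (cong (ι (x ≡ᵇ b) +_) (bs-snoc s c b))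
    (trans (sym (+-assoc (ι (x ≡ᵇ b)) _ _)) (cong (_+ ι (c ≡ᵇ b)) (sym (bs-cons x s b)))))


-- For a noncrossing partition read left to right, the blocks that can still
-- receive elements form a stack; `openStack` simulates it.
module OpenBlockStack where

  open import Data.Nat
  open import Data.Nat.Properties
  open import Data.Bool using (Bool; true; false; if_then_else_)
  open import Data.List using (List; []; _∷_; _++_; foldl)
  open import Data.List.Properties using (foldl-++)
  open import Data.List.Relation.Unary.All as All using (All; []; _∷_)
  open import Data.List.Relation.Unary.All.Properties using (++⁻ʳ)
  open import Data.Bool.ListAction using (any)
  open import Relation.Binary.PropositionalEquality
  open import Data.Product using (Σ; _×_; _,_)
  open import Data.Unit using (⊤; tt)
  open RangeSums

  mem : ℕ → List ℕ → Bool
  mem b xs = any (λ a → a ≡ᵇ b) xs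

  popTo : ℕ → List ℕ → List ℕ
  popTo c [] = []
  popTo c (a ∷ st) = if a ≡ᵇ c then a ∷ st else popTo c st

  pushOrPop : List ℕ → ℕ → List ℕ
  pushOrPop st c = if mem c st then popTo c st else c ∷ st

  openStack : List ℕ → List ℕ
  openStack s = foldl pushOrPop [] s

  openStack-snoc : ∀ s c → openStack (s ++ c ∷ []) ≡ pushOrPop (openStack s) c
  openStack-snoc s c = foldl-++ pushOrPop [] s (c ∷ [])

  SortedBy : (ℕ → ℕ) → List ℕ → Set
  SortedBy f [] = ⊤
  SortedBy f (a ∷ xs) = All (λ b → f b < f a) xs × SortedBy f xs

  mem-All : ∀ {Q : ℕ → Set} {b} xs → All Q xs → mem b xs ≡ true → Q b
  mem-All {b = b} (a ∷ xs) (qa ∷ qs) e with a ≡ᵇ b in eq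
  ... | true rewrite eqb-≡ a b eq = qa
  ... | false = mem-All xs qs e

  mem-false : ∀ {b} xs → All (λ a → a ≢ b) xs → mem b xs ≡ false
  mem-false [] [] = refl
  mem-false {b} (a ∷ xs) (p ∷ ps) rewrite eqb-≢ a b p = mem-false xs ps

  mem-split : ∀ l st → mem l st ≡ true → Σ (List ℕ) λ pre → Σ (List ℕ) λ rest → st ≡ pre ++ l ∷ rest × All (λ a → (a ≡ᵇ l) ≡ false) pre
  mem-split l (a ∷ st) e with a ≡ᵇ l in eq
  ... | true rewrite eqb-≡ a l eq = [] , st , refl , []
  ... | false = let (pre , rest , q , al) = mem-split l st e in (a ∷ pre) , rest , cong (a ∷_) q , (eq ∷ al)

  popTo-split : ∀ l pre rest → All (λ a → (a ≡ᵇ l) ≡ false) pre → popTo l (pre ++ l ∷ rest) ≡ l ∷ rest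
  popTo-split l [] rest [] rewrite eqb-refl l = refl
  popTo-split l (a ∷ pre) rest (e ∷ es) rewrite e = popTo-split l pre rest es

  SortedBy-split : ∀ f pre l rest → SortedBy f (pre ++ l ∷ rest) → All (λ a → f l < f a) pre × All (λ b → f b < f l) rest × SortedBy f rest
  SortedBy-split f [] l rest (a , b) = [] , a , b
  SortedBy-split f (p ∷ pre) l rest (p-above , sorted) =
    let (pre-above , rest-below , rest-sorted) = SortedBy-split f pre l rest sorted
    in (All.head (++⁻ʳ pre p-above) ∷ pre-above) , rest-below , rest-sorted

  SortedBy-cong : ∀ {f g} xs → All (λ a → f a ≡ g a) xs → SortedBy f xs → SortedBy g xs
  SortedBy-cong [] _ _ = tt
  SortedBy-cong {f} {g} (a ∷ xs) (ea ∷ es) (alls , srt) = All.zipWith (λ (eb , lt) → subst₂ _<_ eb ea lt) (es , alls) , SortedBy-cong xs es srt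

  SortedBy-distinct : ∀ {f : ℕ → ℕ} (a : ℕ) (xs : List ℕ) → All (λ b → f b < f a) xs → All (λ b → b ≢ a) xs
  SortedBy-distinct {f} a xs al = All.map below⇒≢ al
    where
    below⇒≢ : ∀ {b} → f b < f a → b ≢ a
    below⇒≢ lt e = <-irrefl (cong f e) lt


module GrowthInvariant where

  open import Data.Nat
  open import Data.Nat.Properties
  open import Data.Bool using (Bool; true; false; _∧_; _∨_; not; if_then_else_)
  open import Data.Bool.Properties using (∨-identityʳ; ∨-comm)
  open import Data.List using (List; []; _∷_; _++_; length)
  open import Data.List.Relation.Unary.All as All using (All; []; _∷_)
  open import Data.List.Relation.Unary.All.Properties using (++⁻ʳ)
  open import Relation.Binary.PropositionalEquality
  open import Relation.Nullary using (yes; no)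
  open import Data.Product using (Σ; _×_; _,_; proj₁; proj₂)
  open import Data.Sum using (_⊎_; inj₂)
  open import Defs
  open RangeSums
  open ArcEnumeration
  open AppendArcs
  open AppendStatistics
  open OpenBlockStack

  record StackInv (s : List ℕ) (m : ℕ) : Set where
    field
      jn≡ : ∀ b → b < m → canJoin s b ≡ mem b (openStack s)
      srt : SortedBy (lastPos s) (openStack s)
      bnd : All (_< m) (openStack s)

  record LastLabel (s : List ℕ) (m : ℕ) : Set where
    field
      d : ℕ
      d<m : d < m
      lp≡ : ∀ b → (length s ≡ᵇ lastPos s b) ≡ (d ≡ᵇ b)
      hd : isNC s ≡ true → Σ (List ℕ) (λ rest → openStack s ≡ d ∷ rest)

  record GrowthInv (n : ℕ) (s : List ℕ) (m : ℕ) : Set where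
    field
      len : length s ≡ n
      occ≡ : ∀ b → occurs s b ≡ (b <ᵇ m)
      bs≡ : ∀ b → (0 <ᵇ blockSize s b) ≡ (b <ᵇ m)
      nb≡ : blocksFrom s 0 ≡ m
      nci : isNC s ≡ true → StackInv s m
      lst : (s ≡ [] × m ≡ 0) ⊎ LastLabel s m

  lt-suc-or : ∀ b m → ((b <ᵇ m) ∨ (m ≡ᵇ b)) ≡ (b <ᵇ suc m)
  lt-suc-or zero zero = refl
  lt-suc-or zero (suc m) = refl
  lt-suc-or (suc b) zero = refl
  lt-suc-or (suc b) (suc m) = lt-suc-or b m

  lt-or-old : ∀ b l m → l < m → ((b <ᵇ m) ∨ (l ≡ᵇ b)) ≡ (b <ᵇ m)
  lt-or-old b l m l<m with l ≡ᵇ b in e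
  ... | true rewrite sym (eqb-≡ l b e) | ltb-true l m l<m = refl
  ... | false = ∨-identityʳ _

  pos-+ι : ∀ x t → (0 <ᵇ (x + ι t)) ≡ ((0 <ᵇ x) ∨ t)
  pos-+ι zero true = refl
  pos-+ι zero false = refl
  pos-+ι (suc x) t = refl

  lastPos-append-isEnd : ∀ s c b → (length (s ++ c ∷ []) ≡ᵇ lastPos (s ++ c ∷ []) b) ≡ (c ≡ᵇ b)
  lastPos-append-isEnd s c b = trans (cong₂ _≡ᵇ_ (length-snoc s c) (lastPos-snoc s c b)) (go (c ≡ᵇ b) refl)
    where
    go : ∀ t → (c ≡ᵇ b) ≡ t → (suc (length s) ≡ᵇ (if c ≡ᵇ b then suc (length s) else lastPos s b)) ≡ (c ≡ᵇ b)
    go true e rewrite e = eqb-refl (length s)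
    go false e rewrite e = eqb-≢ (suc (length s)) (lastPos s b) (λ q → <-irrefl (sym q) (s≤s (lastTo-≤ (hasLabel s b) (length s))))

  ∧-true₁ : ∀ a b → a ∧ b ≡ true → a ≡ true
  ∧-true₁ true b _ = refl

  ∧-true₂ : ∀ a b → a ∧ b ≡ true → b ≡ true
  ∧-true₂ true b e = e

  lastPos-append-other : ∀ s c a → a ≢ c → lastPos (s ++ c ∷ []) a ≡ lastPos s a
  lastPos-append-other s c a a≢c = trans (lastPos-snoc s c a) (cong (λ z → if z then suc (length s) else lastPos s a) (eqb-≢ c a (λ e → a≢c (sym e))))

  lastPos-append-self : ∀ s c → lastPos (s ++ c ∷ []) c ≡ suc (length s)
  lastPos-append-self s c = trans (lastPos-snoc s c c) (cong (λ z → if z then suc (length s) else lastPos s c) (eqb-refl c))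

  lastPos-append-< : ∀ s c a → a ≢ c → lastPos (s ++ c ∷ []) a < lastPos (s ++ c ∷ []) c
  lastPos-append-< s c a a≢c = subst₂ _<_ (sym (lastPos-append-other s c a a≢c)) (sym (lastPos-append-self s c)) (s≤s (lastTo-≤ (hasLabel s a) (length s)))

  module _ {n s m} (I : GrowthInv n s m) where
    open GrowthInv I

    private
      s' : List ℕ
      s' = s ++ m ∷ []

    appendNew-stack : isNC s' ≡ true → openStack s' ≡ m ∷ openStack s × StackInv s' (suc m)
    appendNew-stack nc' = stack'≡ , record { jn≡ = joinable ; srt = sorted' ; bnd = subst (All (_< suc m)) (sym stack'≡) (≤-refl ∷ All.map m<n⇒m<1+n (StackInv.bnd N)) }
      where
      nc : isNC s ≡ true
      nc = ∧-true₁ _ _ (trans (sym (isNC-snoc s m)) nc')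
      N : StackInv s m
      N = nci nc
      stack : List ℕ
      stack = openStack s
      stack≢m : All (λ a → a ≢ m) stack
      stack≢m = All.map (λ lt eq → <-irrefl eq lt) (StackInv.bnd N)
      stack'≡ : openStack s' ≡ m ∷ stack
      stack'≡ = trans (openStack-snoc s m) (cong (λ z → if z then popTo m stack else m ∷ stack) (mem-false stack stack≢m))
      joinable : ∀ b → b < suc m → canJoin s' b ≡ mem b (openStack s')
      joinable b b<sm rewrite stack'≡ with b ≟ m
      ... | yes refl = trans (canJoin-self s b) (sym (cong (_∨ mem b stack) (eqb-refl b)))
      ... | no b≢m = begin
          canJoin s' b ≡⟨ canJoin-other s m b b≢m ⟩
          not (occurs s b ∧ (coveredLast s b ∨ (occurs s m ∧ (lastPos s m <ᵇ lastPos s b))))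
            ≡⟨ cong (λ z → not (occurs s b ∧ (coveredLast s b ∨ (z ∧ (lastPos s m <ᵇ lastPos s b))))) (trans (occ≡ m) (ltb-false m m ≤-refl)) ⟩
          not (occurs s b ∧ (coveredLast s b ∨ false))
            ≡⟨ cong (λ z → not (occurs s b ∧ z)) (∨-identityʳ _) ⟩
          canJoin s b ≡⟨ StackInv.jn≡ N b (≤∧≢⇒< (≤-pred b<sm) b≢m) ⟩
          mem b stack ≡⟨ cong (_∨ mem b stack) (sym (eqb-≢ m b (λ q → b≢m (sym q)))) ⟩
          (m ≡ᵇ b) ∨ mem b stack ∎
        where open ≡-Reasoning
      sorted' : SortedBy (lastPos s') (openStack s')
      sorted' rewrite stack'≡ = All.map (λ {a} a≢m → lastPos-append-< s m a a≢m) stack≢m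
                      , SortedBy-cong stack (All.map (λ {a} a≢m → sym (lastPos-append-other s m a a≢m)) stack≢m) (StackInv.srt N)

    growthInv-appendNew : GrowthInv (suc n) s' (suc m)
    growthInv-appendNew = record
      { len = trans (length-snoc s m) (cong suc len)
      ; occ≡ = λ b → trans (occurs-snoc s m b) (trans (cong (_∨ (m ≡ᵇ b)) (occ≡ b)) (lt-suc-or b m))
      ; bs≡ = λ b → trans (cong (0 <ᵇ_) (bs-snoc s m b)) (trans (pos-+ι (blockSize s b) (m ≡ᵇ b)) (trans (cong (_∨ (m ≡ᵇ b)) (bs≡ b)) (lt-suc-or b m)))
      ; nb≡ = trans (blocksFrom-snoc s m 0) (trans (cong (λ z → if m <ᵇ z then z else suc m) nb≡) (cong (λ z → if z then m else suc m) (ltb-false m m ≤-refl)))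
      ; nci = λ e → proj₂ (appendNew-stack e)
      ; lst = inj₂ (record { d = m ; d<m = ≤-refl ; lp≡ = lastPos-append-isEnd s m ; hd = λ e → openStack s , proj₁ (appendNew-stack e) })
      }

  not-∨-decided : ∀ X K mp mr → not X ≡ mp ∨ mr → (mr ≡ true → K ≡ false) → (mp ≡ true → K ≡ true) → not (X ∨ K) ≡ mr
  not-∨-decided X K mp true h h1 h2 rewrite h1 refl | ∨-identityʳ X | ∨-comm mp true = h
  not-∨-decided X K true false h h1 h2 rewrite h2 refl | ∨-comm X true = refl
  not-∨-decided true K false false h h1 h2 = refl
  not-∨-decided false K false false () h1 h2

  module _ {n s m l} (I : GrowthInv n s m) (l<m : l < m) where
    open GrowthInv I

    private
      s' : List ℕ
      s' = s ++ l ∷ []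

    module AppendOld (nc' : isNC s' ≡ true) where
      nc : isNC s ≡ true
      nc = ∧-true₁ _ _ (trans (sym (isNC-snoc s l)) nc')
      N : StackInv s m
      N = nci nc
      stack : List ℕ
      stack = openStack s
      l∈stack : mem l stack ≡ true
      l∈stack = trans (sym (StackInv.jn≡ N l l<m)) (∧-true₂ _ _ (trans (sym (isNC-snoc s l)) nc'))

      split : Σ (List ℕ) λ pre → Σ (List ℕ) λ rest → stack ≡ pre ++ l ∷ rest × All (λ a → (a ≡ᵇ l) ≡ false) pre
      split = mem-split l stack l∈stack
      pre : List ℕ
      pre = proj₁ split
      rest : List ℕ
      rest = proj₁ (proj₂ split)
      stack≡ : stack ≡ pre ++ l ∷ rest
      stack≡ = proj₁ (proj₂ (proj₂ split))

      stack'≡ : openStack s' ≡ l ∷ rest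
      stack'≡ = trans (openStack-snoc s l) (trans (cong (λ z → if z then popTo l stack else l ∷ stack) l∈stack)
                  (trans (cong (popTo l) stack≡) (popTo-split l pre rest (proj₂ (proj₂ (proj₂ split))))))

      sorted : All (λ a → lastPos s l < lastPos s a) pre × All (λ a → lastPos s a < lastPos s l) rest × SortedBy (lastPos s) rest
      sorted = SortedBy-split (lastPos s) pre l rest (subst (SortedBy (lastPos s)) stack≡ (StackInv.srt N))
      rest≢l : All (λ a → a ≢ l) rest
      rest≢l = SortedBy-distinct l rest (proj₁ (proj₂ sorted))

      -- The new arc (lastPos s l, n+1) covers exactly the blocks above l, so the
      -- joinable labels are those of l ∷ rest.
      joinable : ∀ b → b < m → canJoin s' b ≡ mem b (openStack s')
      joinable b b<m rewrite stack'≡ with b ≟ l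
      ... | yes refl = trans (canJoin-self s b) (sym (cong (_∨ mem b rest) (eqb-refl b)))
      ... | no b≢l = trans (canJoin-other s l b b≢l) (trans unfold-occurs
                       (trans (not-∨-decided (coveredLast s b) K (mem b pre) (mem b rest) joinable-before in-rest in-pre)
                              (cong (_∨ mem b rest) (sym l≢b))))
        where
        l≢b : (l ≡ᵇ b) ≡ false
        l≢b = eqb-≢ l b (λ q → b≢l (sym q))
        K : Bool
        K = lastPos s l <ᵇ lastPos s b
        b-occurs : occurs s b ≡ true
        b-occurs = trans (occ≡ b) (ltb-true b m b<m)
        unfold-occurs : not (occurs s b ∧ (coveredLast s b ∨ (occurs s l ∧ K))) ≡ not (coveredLast s b ∨ K)
        unfold-occurs rewrite b-occurs | trans (occ≡ l) (ltb-true l m l<m) = refl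
        joinable-before : not (coveredLast s b) ≡ mem b pre ∨ mem b rest
        joinable-before = trans (cong (λ z → not (z ∧ coveredLast s b)) (sym b-occurs))
          (trans (StackInv.jn≡ N b b<m) (trans (trans (cong (mem b) stack≡) (any-++ (λ a → a ≡ᵇ b) pre (l ∷ rest)))
                                               (cong (λ z → mem b pre ∨ (z ∨ mem b rest)) l≢b)))
        in-rest : mem b rest ≡ true → K ≡ false
        in-rest q = ltb-false (lastPos s l) (lastPos s b) (<⇒≤ (mem-All rest (proj₁ (proj₂ sorted)) q))
        in-pre : mem b pre ≡ true → K ≡ true
        in-pre q = ltb-true (lastPos s l) (lastPos s b) (mem-All pre (proj₁ sorted) q)

      sorted' : SortedBy (lastPos s') (openStack s')
      sorted' rewrite stack'≡ = All.map (λ {a} a≢l → lastPos-append-< s l a a≢l) rest≢l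
                              , SortedBy-cong rest (All.map (λ {a} a≢l → sym (lastPos-append-other s l a a≢l)) rest≢l) (proj₂ (proj₂ sorted))

      bounded' : All (_< m) (openStack s')
      bounded' = subst (All (_< m)) (sym stack'≡) (l<m ∷ All.tail (++⁻ʳ pre (subst (All (_< m)) stack≡ (StackInv.bnd N))))

    appendOld-stack : isNC s' ≡ true → Σ (List ℕ) (λ rest → openStack s' ≡ l ∷ rest) × StackInv s' m
    appendOld-stack nc' = (rest , stack'≡) , record { jn≡ = joinable ; srt = sorted' ; bnd = bounded' }
      where open AppendOld nc'

    growthInv-appendOld : GrowthInv (suc n) s' m
    growthInv-appendOld = record
      { len = trans (length-snoc s l) (cong suc len)
      ; occ≡ = λ b → trans (occurs-snoc s l b) (trans (cong (_∨ (l ≡ᵇ b)) (occ≡ b)) (lt-or-old b l m l<m))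
      ; bs≡ = λ b → trans (cong (0 <ᵇ_) (bs-snoc s l b)) (trans (pos-+ι (blockSize s b) (l ≡ᵇ b)) (trans (cong (_∨ (l ≡ᵇ b)) (bs≡ b)) (lt-or-old b l m l<m)))
      ; nb≡ = trans (blocksFrom-snoc s l 0) (trans (cong (λ z → if l <ᵇ z then z else suc l) nb≡) (cong (λ z → if z then m else suc l) (ltb-true l m l<m)))
      ; nci = λ e → proj₂ (appendOld-stack e)
      ; lst = inj₂ (record { d = l ; d<m = l<m ; lp≡ = lastPos-append-isEnd s l ; hd = λ e → proj₁ (appendOld-stack e) })
      }


module GrowthSums where

  open import Data.Nat as ℕ using (ℕ; zero; suc; _<_; _≤_; _≡ᵇ_)
  import Data.Nat.Properties as ℕP
  open import Data.Integer as ℤ using (ℤ; +_; _+_; _*_; 0ℤ; 1ℤ)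
  open import Data.Integer.Properties using (+-identityˡ; +-assoc; *-identityʳ)
  open import Data.Bool using (Bool; true; false; if_then_else_)
  open import Data.List using (List; []; _∷_; _++_; map; concatMap; concat; filter; upTo; applyUpTo)
  open import Relation.Nullary.Decidable using (T?)
  open import Data.List.Relation.Unary.All as All using (All; []; _∷_)
  open import Data.List.Relation.Unary.All.Properties using (++⁺; applyUpTo⁺₁)
  open import Data.List.Properties using (map-upTo)
  open import Relation.Binary.PropositionalEquality
  open import Relation.Nullary using (yes; no)
  open import Data.Product using (_×_; _,_; proj₁; proj₂)
  open import Data.Sum using (inj₁; inj₂)
  open import Function using (_∘_)
  open import Defs
  open RangeSums
  open IntSums
  open AppendArcs
  open AppendStatistics
  open OpenBlockStack
  open GrowthInvariant

  extensions : List ℕ × ℕ → List (List ℕ × ℕ)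
  extensions (s , m) = map (λ l → (s ++ (l ∷ [])) , (if l ≡ᵇ m then suc m else m)) (upTo (suc m))

  rgsSum : (List ℕ × ℕ → ℤ) → ℕ → ℤ
  rgsSum g n = sumℤ (map g (rgs n))

  sumℤ-++ : ∀ (g : List ℕ × ℕ → ℤ) xs ys → sumℤ (map g (xs ++ ys)) ≡ sumℤ (map g xs) + sumℤ (map g ys)
  sumℤ-++ g [] ys = sym (+-identityˡ _)
  sumℤ-++ g (x ∷ xs) ys rewrite sumℤ-++ g xs ys = sym (+-assoc (g x) _ _)

  sumℤ-concatMap : ∀ (g : List ℕ × ℕ → ℤ) xs → sumℤ (map g (concatMap extensions xs)) ≡ sumℤ (map (λ p → sumℤ (map g (extensions p))) xs)
  sumℤ-concatMap g [] = refl
  sumℤ-concatMap g (x ∷ xs) = trans (sumℤ-++ g (extensions x) (concat (map extensions xs))) (cong (λ z → sumℤ (map g (extensions x)) + z) (sumℤ-concatMap g xs))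

  sumℤ-apply : ∀ (f : ℕ → ℤ) (h : ℕ → ℕ) k → sumℤ (map f (applyUpTo h k)) ≡ Σℤ (f ∘ h) k
  sumℤ-apply f h zero = refl
  sumℤ-apply f h (suc k) = trans (cong (λ z → f (h 0) + z) (sumℤ-apply f (h ∘ suc) k)) (sym (Σℤ-front (f ∘ h) k))

  sumℤ-map-map : ∀ {A : Set} (g : List ℕ × ℕ → ℤ) (h : A → List ℕ × ℕ) xs → sumℤ (map g (map h xs)) ≡ sumℤ (map (g ∘ h) xs)
  sumℤ-map-map g h [] = refl
  sumℤ-map-map g h (x ∷ xs) = cong (λ z → g (h x) + z) (sumℤ-map-map g h xs)

  extendSum : (List ℕ × ℕ → ℤ) → List ℕ × ℕ → ℤ
  extendSum g p = Σℤ (λ l → g ((proj₁ p ++ l ∷ []) , (if l ≡ᵇ proj₂ p then suc (proj₂ p) else proj₂ p))) (suc (proj₂ p))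

  rgsSum-extend : ∀ g n → rgsSum g (suc n) ≡ rgsSum (extendSum g) n
  rgsSum-extend g n = trans (sumℤ-concatMap g (rgs n)) (cong sumℤ (map-cong-ext (rgs n)))
    where
    extensions-sum : ∀ p → sumℤ (map g (extensions p)) ≡ extendSum g p
    extensions-sum (s , m) = trans (sumℤ-map-map g _ (upTo (suc m))) (sumℤ-apply _ (λ z → z) (suc m))
    map-cong-ext : ∀ xs → map (λ p → sumℤ (map g (extensions p))) xs ≡ map (extendSum g) xs
    map-cong-ext [] = refl
    map-cong-ext (x ∷ xs) = cong₂ _∷_ (extensions-sum x) (map-cong-ext xs)

  GrowthInvAt : ℕ → List ℕ × ℕ → Set
  GrowthInvAt n p = GrowthInv n (proj₁ p) (proj₂ p)

  growthInv-empty : GrowthInv 0 [] 0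
  growthInv-empty = record
    { len = refl ; occ≡ = λ b → refl ; bs≡ = λ b → refl ; nb≡ = refl
    ; nci = λ _ → record { jn≡ = λ b () ; srt = _ ; bnd = [] }
    ; lst = inj₁ (refl , refl) }

  growthInv-extend : ∀ {n s m} l → GrowthInv n s m → l < suc m → GrowthInv (suc n) (s ++ l ∷ []) (if l ≡ᵇ m then suc m else m)
  growthInv-extend {m = m} l I l<sm with l ℕP.≟ m
  ... | yes refl rewrite eqb-refl l = growthInv-appendNew I
  ... | no l≢m rewrite eqb-≢ l m l≢m = growthInv-appendOld I (ℕP.≤∧≢⇒< (ℕP.≤-pred l<sm) l≢m)

  All-map-upTo : ∀ {P : List ℕ × ℕ → Set} (h : ℕ → List ℕ × ℕ) k → (∀ l → l < k → P (h l)) → All P (map h (upTo k))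
  All-map-upTo h k f = subst (All _) (sym (map-upTo h k)) (applyUpTo⁺₁ h k (λ {l} → f l))

  growthInv-all : ∀ n → All (GrowthInvAt n) (rgs n)
  growthInv-all zero = growthInv-empty ∷ []
  growthInv-all (suc n) = go (rgs n) (growthInv-all n)
    where
    go : ∀ xs → All (GrowthInvAt n) xs → All (GrowthInvAt (suc n)) (concatMap extensions xs)
    go [] [] = []
    go ((s , m) ∷ xs) (I ∷ Is) = ++⁺ (All-map-upTo _ (suc m) (λ l l<sm → growthInv-extend l I l<sm)) (go xs Is)

  rgsSum-cong : ∀ n {g g' : List ℕ × ℕ → ℤ} → (∀ s m → GrowthInv n s m → g (s , m) ≡ g' (s , m)) → rgsSum g n ≡ rgsSum g' n
  rgsSum-cong n {g} {g'} h = go (rgs n) (growthInv-all n)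
    where
    go : ∀ xs → All (GrowthInvAt n) xs → sumℤ (map g xs) ≡ sumℤ (map g' xs)
    go [] [] = refl
    go ((s , m) ∷ xs) (I ∷ Is) = cong₂ _+_ (h s m I) (go xs Is)

  extendSum-split : ∀ g s m → extendSum g (s , m) ≡ Σℤ (λ l → g ((s ++ l ∷ []) , m)) m + g ((s ++ m ∷ []) , suc m)
  extendSum-split g s m = cong₂ _+_ (Σℤ-cong m (λ l l<m → cong (λ b → g ((s ++ l ∷ []) , (if b then suc m else m))) (eqb-≢ l m (λ e → ℕP.<-irrefl e l<m))))
                                  (cong (λ b → g ((s ++ m ∷ []) , (if b then suc m else m))) (eqb-refl m))

  lastLabel : ∀ {n s m} → GrowthInv n s m → 1 ≤ n → LastLabel s m
  lastLabel I 1≤n with GrowthInv.lst I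
  ... | inj₂ L = L
  ... | inj₁ (refl , _) with GrowthInv.len I
  lastLabel I () | inj₁ (refl , _) | refl

  sumℤ-proj : ∀ (f : List ℕ → ℤ) (xs : List (List ℕ × ℕ)) → sumℤ (map f (map proj₁ xs)) ≡ sumℤ (map (λ p → f (proj₁ p) * 1ℤ) xs)
  sumℤ-proj f [] = refl
  sumℤ-proj f (p ∷ xs) = cong₂ _+_ (sym (*-identityʳ (f (proj₁ p)))) (sumℤ-proj f xs)

  sumℤ-filter : ∀ (q : List ℕ → Bool) (f : List ℕ → ℤ) (xs : List (List ℕ × ℕ)) → sumℤ (map f (filter (λ s → T? (q s)) (map proj₁ xs))) ≡ sumℤ (map (λ p → if q (proj₁ p) then f (proj₁ p) * 1ℤ else 0ℤ) xs)
  sumℤ-filter q f [] = refl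
  sumℤ-filter q f (p ∷ xs) with q (proj₁ p)
  ... | true = cong₂ _+_ (sym (*-identityʳ (f (proj₁ p)))) (sumℤ-filter q f xs)
  ... | false = trans (sumℤ-filter q f xs) (sym (+-identityˡ (sumℤ (map (λ p → if q (proj₁ p) then f (proj₁ p) * 1ℤ else 0ℤ) xs))))


-- Transfer operator for all partitions (state: number of blocks).
module AllPartitions where

  open import Data.Nat as ℕ using (ℕ; zero; suc; _<_; _≤_; s≤s; z≤n; _≡ᵇ_; _∸_)
  import Data.Nat.Properties as ℕP
  open import Data.Integer as ℤ using (ℤ; +_; _+_; _*_; 1ℤ; _^_)
  open import Data.Integer.Properties using (+-identityʳ; +-assoc; +-comm; ^-distribˡ-+-*; *-identityˡ; *-distribʳ-+)
  open import Data.Integer.Tactic.RingSolver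
  open import Data.Bool using (true; false; _∧_; not; if_then_else_)
  open import Data.List using (List; []; _∷_; _++_; length)
  open import Relation.Binary.PropositionalEquality
  open import Relation.Nullary using (yes; no)
  open import Data.Product using (_×_; _,_; proj₁; proj₂)
  open import Defs
  open RangeSums
  open IntSums
  open AppendArcs
  open AppendStatistics
  open GrowthInvariant
  open GrowthSums

  module _ (x y : ℤ) where

    weight : List ℕ → ℤ
    weight s = x ^ nNonCov s * y ^ nCov s

    allWeight : (ℕ → ℤ) → List ℕ × ℕ → ℤ
    allWeight φ p = weight (proj₁ p) * φ (proj₂ p)

    -- The transfer operator for all partitions: appending a new block keeps the
    -- weight; appending to one of the m blocks adds an arc, covering (weight y)
    -- for the block of the last letter and non-covering (weight x) otherwise.
    stepAll : (ℕ → ℤ) → ℕ → ℤ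
    stepAll φ m = φ (suc m) + (y + + (m ∸ 1) * x) * φ m

    weight-factor : ∀ a c t → x ^ (a ℕ.+ ι (not t)) * y ^ (c ℕ.+ ι t) ≡ x ^ a * y ^ c * (if t then y else x)
    weight-factor a c true rewrite ^-distribˡ-+-* x a 0 | ^-distribˡ-+-* y c 1 = algebra (x ^ a) (y ^ c) y
      where algebra : ∀ A C y → A * 1ℤ * (C * (y * 1ℤ)) ≡ A * C * y
            algebra = solve-∀
    weight-factor a c false rewrite ^-distribˡ-+-* x a 1 | ^-distribˡ-+-* y c 0 = algebra (x ^ a) (y ^ c) x
      where algebra : ∀ A C x → A * (x * 1ℤ) * (C * 1ℤ) ≡ A * C * x
            algebra = solve-∀

    weight-old : ∀ {n s m} → GrowthInv n s m → (L : LastLabel s m) → ∀ l → l < m → weight (s ++ l ∷ []) ≡ weight s * (if LastLabel.d L ≡ᵇ l then y else x)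
    weight-old {s = s} {m = m} I L l l<m = begin
      x ^ nNonCov (s ++ l ∷ []) * y ^ nCov (s ++ l ∷ [])
        ≡⟨ cong₂ (λ a c → x ^ a * y ^ c) (nNonCov-snoc s l) (nCov-snoc s l) ⟩
      x ^ (nNonCov s ℕ.+ ι (occurs s l ∧ not (length s ≡ᵇ lastPos s l))) * y ^ (nCov s ℕ.+ ι (occurs s l ∧ (length s ≡ᵇ lastPos s l)))
        ≡⟨ cong₂ (λ o t → x ^ (nNonCov s ℕ.+ ι (o ∧ not t)) * y ^ (nCov s ℕ.+ ι (o ∧ t))) (trans (GrowthInv.occ≡ I l) (ltb-true l m l<m)) (LastLabel.lp≡ L l) ⟩
      x ^ (nNonCov s ℕ.+ ι (not (LastLabel.d L ≡ᵇ l))) * y ^ (nCov s ℕ.+ ι (LastLabel.d L ≡ᵇ l))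
        ≡⟨ weight-factor (nNonCov s) (nCov s) (LastLabel.d L ≡ᵇ l) ⟩
      weight s * (if LastLabel.d L ≡ᵇ l then y else x) ∎
      where
      open ≡-Reasoning

    weight-new : ∀ {n s m} → GrowthInv n s m → weight (s ++ m ∷ []) ≡ weight s
    weight-new {s = s} {m = m} I = begin
      x ^ nNonCov (s ++ m ∷ []) * y ^ nCov (s ++ m ∷ [])
        ≡⟨ cong₂ (λ a c → x ^ a * y ^ c) (nNonCov-snoc s m) (nCov-snoc s m) ⟩
      x ^ (nNonCov s ℕ.+ ι (occurs s m ∧ not (length s ≡ᵇ lastPos s m))) * y ^ (nCov s ℕ.+ ι (occurs s m ∧ (length s ≡ᵇ lastPos s m)))
        ≡⟨ cong (λ o → x ^ (nNonCov s ℕ.+ ι (o ∧ not (length s ≡ᵇ lastPos s m))) * y ^ (nCov s ℕ.+ ι (o ∧ (length s ≡ᵇ lastPos s m)))) (trans (GrowthInv.occ≡ I m) (ltb-false m m ℕP.≤-refl)) ⟩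
      x ^ (nNonCov s ℕ.+ 0) * y ^ (nCov s ℕ.+ 0)
        ≡⟨ cong₂ (λ a c → x ^ a * y ^ c) (ℕP.+-identityʳ (nNonCov s)) (ℕP.+-identityʳ (nCov s)) ⟩
      weight s ∎
      where open ≡-Reasoning

    Σℤ-if-last : ∀ d m → d < m → Σℤ (λ l → if d ≡ᵇ l then y else x) m ≡ y + + (m ∸ 1) * x
    Σℤ-if-last d (suc m) d<sm with d ℕP.≟ m
    ... | yes refl = trans (cong₂ _+_ (trans (Σℤ-cong d (λ l l<d → cong (λ b → if b then y else x) (eqb-≢ d l (λ e → ℕP.<-irrefl (sym e) l<d)))) (Σℤ-const x d)) (cong (λ b → if b then y else x) (eqb-refl d))) (+-comm _ y)
    ... | no d≢m with m | ℕP.≤∧≢⇒< (ℕP.≤-pred d<sm) d≢m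
    ...   | suc m' | d<m = trans (cong₂ _+_ (Σℤ-if-last d (suc m') d<m) (cong (λ b → if b then y else x) (eqb-≢ d (suc m') (λ e → ℕP.<-irrefl e d<m))))
          (trans (+-assoc y _ x) (cong (λ z → y + z) (trans (+-comm _ x) (sym (trans (*-distribʳ-+ x (+ 1) (+ m')) (cong (_+ (+ m' * x)) (*-identityˡ x)))))))

    extend-all : ∀ φ {n s m} → GrowthInv n s m → LastLabel s m → extendSum (allWeight φ) (s , m) ≡ allWeight (stepAll φ) (s , m)
    extend-all φ {s = s} {m = m} I L = begin
      extendSum (allWeight φ) (s , m)
        ≡⟨ extendSum-split (allWeight φ) s m ⟩
      Σℤ (λ l → weight (s ++ l ∷ []) * φ m) m + weight (s ++ m ∷ []) * φ (suc m)
        ≡⟨ cong₂ _+_ (Σℤ-cong m (λ l l<m → trans (cong (_* φ m) (weight-old I L l l<m)) (rotate (weight s) _ (φ m)))) (cong (_* φ (suc m)) (weight-new I)) ⟩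
      Σℤ (λ l → (weight s * φ m) * (if LastLabel.d L ≡ᵇ l then y else x)) m + weight s * φ (suc m)
        ≡⟨ cong (_+ weight s * φ (suc m)) (trans (Σℤ-* (weight s * φ m) _ m) (cong ((weight s * φ m) *_) (Σℤ-if-last (LastLabel.d L) m (LastLabel.d<m L)))) ⟩
      (weight s * φ m) * (y + + (m ∸ 1) * x) + weight s * φ (suc m)
        ≡⟨ regroup (weight s) (φ m) (φ (suc m)) (y + + (m ∸ 1) * x) ⟩
      weight s * (φ (suc m) + (y + + (m ∸ 1) * x) * φ m) ∎
      where
      open ≡-Reasoning
      rotate : ∀ a b c → a * b * c ≡ (a * c) * b
      rotate = solve-∀
      regroup : ∀ a b c k → (a * b) * k + a * c ≡ a * (c + k * b)
      regroup = solve-∀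

    rgsSum-all-step : ∀ φ n → 1 ≤ n → rgsSum (allWeight φ) (suc n) ≡ rgsSum (allWeight (stepAll φ)) n
    rgsSum-all-step φ n 1≤n = trans (rgsSum-extend (allWeight φ) n) (rgsSum-cong n (λ s m I → extend-all φ I (lastLabel I 1≤n)))

    rgsSum-all-1 : ∀ φ → rgsSum (allWeight φ) 1 ≡ φ 1
    rgsSum-all-1 φ = trans (+-identityʳ _) (*-identityˡ (φ 1))

    rgsSum-all-iterate : ∀ k φ → rgsSum (allWeight φ) (suc k) ≡ iter stepAll k φ 1
    rgsSum-all-iterate zero φ = rgsSum-all-1 φ
    rgsSum-all-iterate (suc k) φ = trans (rgsSum-all-step φ (suc k) (s≤s z≤n)) (rgsSum-all-iterate k (stepAll φ))

    stepAll-cong : ∀ {f g : ℕ → ℤ} → (∀ p → f p ≡ g p) → ∀ p → stepAll f p ≡ stepAll g p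
    stepAll-cong e p = cong₂ _+_ (e (suc p)) (cong ((y + + (p ∸ 1) * x) *_) (e p))

    stepAll-lin : ∀ (f g : ℕ → ℤ) (k : ℤ) p → stepAll (λ q → f q + k * g q) p ≡ stepAll f p + k * stepAll g p
    stepAll-lin f g k p = algebra (f (suc p)) (g (suc p)) (f p) (g p) k (y + + (p ∸ 1) * x)
      where algebra : ∀ a b c d k K → a + k * b + K * (c + k * d) ≡ a + K * c + k * (b + K * d)
            algebra = solve-∀

    𝓑-iterate : ∀ k → 𝓑 (suc k) x y ≡ iter stepAll k (λ _ → 1ℤ) 1
    𝓑-iterate k = trans (sumℤ-proj weight (rgs (suc k))) (rgsSum-all-iterate k (λ _ → 1ℤ))


-- Transfer operator for the arc count with singletons tracked (state: number of
-- singleton and of larger blocks); 𝓕 keeps the strings without singletons.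
module FeasiblePartitions where

  open import Data.Nat as ℕ using (ℕ; zero; suc; _<_; _≤_; s≤s; z≤n; _≡ᵇ_; _<ᵇ_; _∸_)
  import Data.Nat.Properties as ℕP
  open import Data.Integer as ℤ using (ℤ; +_; _+_; _*_; 0ℤ; 1ℤ; _^_)
  open import Data.Integer.Properties using (+-identityʳ; +-comm; ^-distribˡ-+-*; *-identityʳ; *-identityˡ; *-zeroˡ; *-zeroʳ)
  open import Data.Integer.Tactic.RingSolver
  open import Data.Bool using (Bool; true; false; if_then_else_)
  open import Data.Bool.Properties using (∧-zeroʳ; ∧-identityʳ)
  open import Data.Bool.ListAction using (all)
  open import Data.List using (List; []; _∷_; _++_; upTo)
  open import Relation.Binary.PropositionalEquality
  open import Relation.Nullary using (yes; no)
  open import Data.Product using (_×_; _,_; proj₁; proj₂)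
  open import Function using (_∘_)
  open import Defs
  open RangeSums
  open IntSums
  open AppendArcs
  open AppendStatistics
  open GrowthInvariant
  open GrowthSums

  singletons : List ℕ → ℕ → ℕ
  singletons s m = sumTo (λ b → ι (blockSize s b ≡ᵇ 1)) m

  sumTo-indicator≤ : ∀ (q : ℕ → Bool) m → sumTo (ι ∘ q) m ≤ m
  sumTo-indicator≤ q zero = z≤n
  sumTo-indicator≤ q (suc m) with q m
  ... | true = ℕP.≤-trans (ℕP.≤-reflexive (ℕP.+-comm _ 1)) (s≤s (sumTo-indicator≤ q m))
  ... | false = ℕP.≤-trans (ℕP.≤-reflexive (ℕP.+-identityʳ _)) (ℕP.m≤n⇒m≤1+n (sumTo-indicator≤ q m))

  Σℤ-if-count : ∀ (q : ℕ → Bool) (A B : ℤ) m → Σℤ (λ l → if q l then A else B) m ≡ + sumTo (ι ∘ q) m * A + + (m ∸ sumTo (ι ∘ q) m) * B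
  Σℤ-if-count q A B zero = sym (cong₂ _+_ (*-zeroˡ A) (*-zeroˡ B))
  Σℤ-if-count q A B (suc m) with q m | sumTo-indicator≤ q m
  ... | true | c≤m rewrite Σℤ-if-count q A B m | ℕP.+-comm (sumTo (ι ∘ q) m) 1 = algebra (+ sumTo (ι ∘ q) m) (+ (m ∸ sumTo (ι ∘ q) m)) A B
    where algebra : ∀ c r A B → c * A + r * B + A ≡ (+ 1 + c) * A + r * B
          algebra = solve-∀
  ... | false | c≤m rewrite Σℤ-if-count q A B m | ℕP.+-identityʳ (sumTo (ι ∘ q) m) | ℕP.+-∸-assoc 1 c≤m = algebra (+ sumTo (ι ∘ q) m) (+ (m ∸ sumTo (ι ∘ q) m)) A B
    where algebra : ∀ c r A B → c * A + r * B + B ≡ c * A + (+ 1 + r) * B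
          algebra = solve-∀

  allTo-count : ∀ (v : ℕ → ℕ) m → (∀ b → b < m → 1 ≤ v b) → allTo (λ b → 1 <ᵇ v b) m ≡ (sumTo (λ b → ι (v b ≡ᵇ 1)) m ≡ᵇ 0)
  allTo-count v zero h = refl
  allTo-count v (suc m) h with v m | h m ℕP.≤-refl | allTo-count v m (λ b b<m → h b (ℕP.m<n⇒m<1+n b<m))
  ... | suc zero | _ | ih rewrite ih | ℕP.+-comm (sumTo (λ b → ι (v b ≡ᵇ 1)) m) 1 = ∧-zeroʳ (sumTo (λ b → ι (v b ≡ᵇ 1)) m ≡ᵇ 0)
  ... | suc (suc _) | _ | ih rewrite ih | ℕP.+-identityʳ (sumTo (λ b → ι (v b ≡ᵇ 1)) m) = ∧-identityʳ (sumTo (λ b → ι (v b ≡ᵇ 1)) m ≡ᵇ 0)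

  isFeasible-singletons : ∀ {n s m} → GrowthInv n s m → isFeasible s ≡ (singletons s m ≡ᵇ 0)
  isFeasible-singletons {s = s} {m = m} I = trans (cong (λ z → all (λ b → 1 <ᵇ blockSize s b) (upTo z)) (trans (nBlocks≡ s) (GrowthInv.nb≡ I)))
     (trans (all-apply (λ b → 1 <ᵇ blockSize s b) (λ z → z) m) (allTo-count (blockSize s) m (λ b b<m → ltb-sound 0 (blockSize s b) (trans (GrowthInv.bs≡ I b) (ltb-true b m b<m)))))

  unitAt00 : ℕ → ℕ → ℤ
  unitAt00 j k = if j ≡ᵇ 0 then 1ℤ else 0ℤ

  module _ (x : ℤ) where

    -- The weight of a string carried by a function ψ of the state (j, k) =
    -- (number of singleton blocks, number of larger blocks).
    feasWeight : (ℕ → ℕ → ℤ) → List ℕ × ℕ → ℤ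
    feasWeight ψ p = x ^ nArc (proj₁ p) * ψ (singletons (proj₁ p) (proj₂ p)) (proj₂ p ∸ singletons (proj₁ p) (proj₂ p))

    -- The feasible transfer operator: a new label creates a singleton; joining one
    -- of the j singletons or one of the k larger blocks adds an arc (weight x).
    stepFeas : (ℕ → ℕ → ℤ) → ℕ → ℕ → ℤ
    stepFeas ψ j k = ψ (suc j) k + x * (+ j * ψ (j ∸ 1) (suc k) + + k * ψ j k)

    module _ {n s m} (I : GrowthInv n s m) where
      open GrowthInv I

      bs-pos : ∀ b → b < m → 1 ≤ blockSize s b
      bs-pos b b<m = ltb-sound 0 (blockSize s b) (trans (bs≡ b) (ltb-true b m b<m))

      bs-m : blockSize s m ≡ 0
      bs-m with blockSize s m | bs≡ m
      ... | zero | _ = refl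
      ... | suc v | e = ⊥-elim' (contra (trans e (ltb-false m m ℕP.≤-refl)))
        where
        open import Data.Empty renaming (⊥-elim to ⊥-elim')
        contra : true ≡ false → Data.Empty.⊥
        contra ()

      singletons-appendNew : singletons (s ++ m ∷ []) (suc m) ≡ suc (singletons s m)
      singletons-appendNew = trans (cong₂ ℕ._+_ (sumTo-cong m (λ b b<m → cong (λ z → ι (z ≡ᵇ 1)) (trans (bs-snoc s m b) (trans (cong (blockSize s b ℕ.+_) (cong ι (eqb-≢ m b (λ e → ℕP.<-irrefl (sym e) b<m)))) (ℕP.+-identityʳ _)))))
                                     (cong (λ z → ι (z ≡ᵇ 1)) (trans (bs-snoc s m m) (cong₂ ℕ._+_ bs-m (cong ι (eqb-refl m))))))
                       (ℕP.+-comm _ 1)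

      q : ℕ → Bool
      q l = blockSize s l ≡ᵇ 1

      singletons-appendOld : ∀ l → l < m → singletons (s ++ l ∷ []) m ℕ.+ ι (q l) ≡ singletons s m
      singletons-appendOld l l<m = begin
        singletons s' m ℕ.+ ι (q l)
          ≡⟨ cong (singletons s' m ℕ.+_) (sym (trans (sumTo-single m l l<m (λ k k<m k≢l → cong (λ b → if b then ι (q l) else 0) (eqb-≢ l k (λ e → k≢l (sym e))))) (cong (λ b → if b then ι (q l) else 0) (eqb-refl l)))) ⟩
        sumTo (λ b → ι (blockSize s' b ≡ᵇ 1)) m ℕ.+ sumTo (λ b → if l ≡ᵇ b then ι (q l) else 0) m
          ≡⟨ sym (sumTo-+ _ _ m) ⟩
        sumTo (λ b → ι (blockSize s' b ≡ᵇ 1) ℕ.+ (if l ≡ᵇ b then ι (q l) else 0)) m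
          ≡⟨ sumTo-cong m pointwise ⟩
        singletons s m ∎
        where
        open ≡-Reasoning
        s' : List ℕ
        s' = s ++ l ∷ []
        pointwise : ∀ b → b < m → ι (blockSize s' b ≡ᵇ 1) ℕ.+ (if l ≡ᵇ b then ι (q l) else 0) ≡ ι (blockSize s b ≡ᵇ 1)
        pointwise b b<m with l ℕP.≟ b
        ... | yes refl rewrite bs-snoc s l l | eqb-refl l with blockSize s l | bs-pos l l<m
        ...   | suc v | _ rewrite ℕP.+-comm v 1 = refl
        pointwise b b<m | no l≢b rewrite bs-snoc s l b | eqb-≢ l b l≢b | ℕP.+-identityʳ (blockSize s b) = ℕP.+-identityʳ _

      singletons≤ : singletons s m ≤ m
      singletons≤ = sumTo-indicator≤ (λ b → blockSize s b ≡ᵇ 1) m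

      term-old : ∀ ψ l → l < m → feasWeight ψ ((s ++ l ∷ []) , m) ≡ (x ^ nArc s * x) * (if q l then ψ (singletons s m ∸ 1) (suc (m ∸ singletons s m)) else ψ (singletons s m) (m ∸ singletons s m))
      term-old ψ l l<m = trans (cong₂ _*_ (trans (cong (x ^_) (trans (nArc-snoc s l) (cong (λ o → nArc s ℕ.+ ι o) (trans (occ≡ l) (ltb-true l m l<m))))) (trans (^-distribˡ-+-* x (nArc s) 1) (cong (x ^ nArc s *_) (*-identityʳ x)))) refl) (cong ((x ^ nArc s * x) *_) (by-type (q l) refl))
        where
        by-type : ∀ t → q l ≡ t → ψ (singletons (s ++ l ∷ []) m) (m ∸ singletons (s ++ l ∷ []) m) ≡ (if t then ψ (singletons s m ∸ 1) (suc (m ∸ singletons s m)) else ψ (singletons s m) (m ∸ singletons s m))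
        by-type true e with singletons (s ++ l ∷ []) m | singletons-appendOld l l<m
        ... | v | e2 rewrite e | sym e2 = cong₂ ψ (sym (ℕP.m+n∸n≡m v 1)) (m∸v≡1+m∸[v+1] m v (ℕP.≤-trans (ℕP.≤-reflexive e2) singletons≤))
          where
          m∸v≡1+m∸[v+1] : ∀ m v → v ℕ.+ 1 ≤ m → m ∸ v ≡ suc (m ∸ (v ℕ.+ 1))
          m∸v≡1+m∸[v+1] (suc m) zero _ = refl
          m∸v≡1+m∸[v+1] (suc m) (suc v) (s≤s le) = m∸v≡1+m∸[v+1] m v le
        by-type false e with singletons (s ++ l ∷ []) m | singletons-appendOld l l<m
        ... | v | e2 rewrite e | sym e2 | ℕP.+-identityʳ v = refl

      extend-feas : ∀ ψ → extendSum (feasWeight ψ) (s , m) ≡ feasWeight (stepFeas ψ) (s , m)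
      extend-feas ψ = begin
        extendSum (feasWeight ψ) (s , m)
          ≡⟨ extendSum-split (feasWeight ψ) s m ⟩
        Σℤ (λ l → feasWeight ψ ((s ++ l ∷ []) , m)) m + feasWeight ψ ((s ++ m ∷ []) , suc m)
          ≡⟨ cong₂ _+_ (Σℤ-cong m (λ l l<m → term-old ψ l l<m)) new-term ⟩
        Σℤ (λ l → (x ^ nArc s * x) * (if q l then A else B)) m + x ^ nArc s * ψ (suc j) (m ∸ j)
          ≡⟨ cong (_+ x ^ nArc s * ψ (suc j) (m ∸ j)) (trans (Σℤ-* (x ^ nArc s * x) _ m) (cong ((x ^ nArc s * x) *_) (Σℤ-if-count q A B m))) ⟩
        (x ^ nArc s * x) * (+ j * A + + (m ∸ j) * B) + x ^ nArc s * ψ (suc j) (m ∸ j)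
          ≡⟨ regroup (x ^ nArc s) x (+ j) (+ (m ∸ j)) A B (ψ (suc j) (m ∸ j)) ⟩
        feasWeight (stepFeas ψ) (s , m) ∎
        where
        open ≡-Reasoning
        j : ℕ
        j = singletons s m
        A : ℤ
        A = ψ (j ∸ 1) (suc (m ∸ j))
        B : ℤ
        B = ψ j (m ∸ j)
        new-term : feasWeight ψ ((s ++ m ∷ []) , suc m) ≡ x ^ nArc s * ψ (suc j) (m ∸ j)
        new-term = cong₂ _*_ (cong (x ^_) (trans (nArc-snoc s m) (trans (cong (λ o → nArc s ℕ.+ ι o) (trans (occ≡ m) (ltb-false m m ℕP.≤-refl))) (ℕP.+-identityʳ _))))
                         (cong (λ z → ψ z (suc m ∸ z)) singletons-appendNew)
        regroup : ∀ P x J K A B C → (P * x) * (J * A + K * B) + P * C ≡ P * (C + x * (J * A + K * B))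
        regroup = solve-∀

    rgsSum-feas-step : ∀ ψ n → rgsSum (feasWeight ψ) (suc n) ≡ rgsSum (feasWeight (stepFeas ψ)) n
    rgsSum-feas-step ψ n = trans (rgsSum-extend (feasWeight ψ) n) (rgsSum-cong n (λ s m I → extend-feas I ψ))

    rgsSum-feas-iterate : ∀ k ψ → rgsSum (feasWeight ψ) k ≡ iter stepFeas k ψ 0 0
    rgsSum-feas-iterate zero ψ = trans (+-identityʳ _) (*-identityˡ (ψ 0 0))
    rgsSum-feas-iterate (suc k) ψ = trans (rgsSum-feas-step ψ k) (rgsSum-feas-iterate k (stepFeas ψ))

    𝓕-iterate : ∀ n → 𝓕 n x ≡ iter stepFeas n unitAt00 0 0
    𝓕-iterate n = trans (sumℤ-filter isFeasible (λ s → x ^ nArc s) (rgs n)) (trans (rgsSum-cong n pointwise) (rgsSum-feas-iterate n unitAt00))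
      where
      pointwise : ∀ s m → GrowthInv n s m → (if isFeasible s then x ^ nArc s * 1ℤ else 0ℤ) ≡ feasWeight unitAt00 (s , m)
      pointwise s m I rewrite isFeasible-singletons I with singletons s m ≡ᵇ 0
      ... | true = refl
      ... | false = sym (*-zeroʳ (x ^ nArc s))


-- Transfer operator for noncrossing partitions (state: depth of the stack of
-- open blocks).
module NoncrossingPartitions where

  open import Data.Nat as ℕ using (ℕ; zero; suc; _<_; _≤_; s≤s; z≤n; _≡ᵇ_; _∸_)
  import Data.Nat.Properties as ℕP
  open import Data.Integer as ℤ using (ℤ; +_; _+_; _*_; 0ℤ; 1ℤ)
  open import Data.Integer.Properties using (*-distribˡ-+; +-identityʳ; +-identityˡ; +-comm; *-identityˡ; *-zeroʳ)
  open import Data.Integer.Tactic.RingSolver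
  open import Data.Bool using (true; false; _∧_; _∨_; not; if_then_else_)
  open import Data.List using (List; []; _∷_; _++_; length; map)
  open import Data.List.Relation.Unary.All as All using (All; []; _∷_)
  open import Relation.Binary.PropositionalEquality
  open import Data.Product using (_×_; _,_; proj₁; proj₂)
  open import Data.Unit using (⊤; tt)
  open import Defs
  open RangeSums
  open IntSums
  open AppendArcs
  open AppendStatistics
  open OpenBlockStack
  open GrowthInvariant
  open GrowthSums
  open AllPartitions using (weight; weight-old; weight-new)

  Distinct : List ℕ → Set
  Distinct [] = ⊤
  Distinct (a ∷ xs) = All (λ b → b ≢ a) xs × Distinct xs

  SortedBy⇒Distinct : ∀ {f} xs → SortedBy f xs → Distinct xs
  SortedBy⇒Distinct [] _ = tt
  SortedBy⇒Distinct (a ∷ xs) (al , s) = SortedBy-distinct a xs al , SortedBy⇒Distinct xs s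

  sumOver : (ℕ → ℤ) → List ℕ → ℤ
  sumOver F [] = 0ℤ
  sumOver F (a ∷ xs) = F a + sumOver F xs

  sumOver-cong : ∀ {F G : ℕ → ℤ} xs → All (λ l → F l ≡ G l) xs → sumOver F xs ≡ sumOver G xs
  sumOver-cong [] [] = refl
  sumOver-cong (a ∷ xs) (e ∷ es) = cong₂ _+_ e (sumOver-cong xs es)

  sumOver-* : ∀ (c : ℤ) (F : ℕ → ℤ) xs → sumOver (λ l → c * F l) xs ≡ c * sumOver F xs
  sumOver-* c F [] = sym (*-zeroʳ c)
  sumOver-* c F (a ∷ xs) rewrite sumOver-* c F xs = sym (*-distribˡ-+ c (F a) (sumOver F xs))

  Σℤ-membership : ∀ xs (F : ℕ → ℤ) m → All (_< m) xs → Distinct xs → Σℤ (λ l → if mem l xs then F l else 0ℤ) m ≡ sumOver F xs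
  Σℤ-membership [] F m [] tt = Σℤ-0 m
  Σℤ-membership (a ∷ xs) F m (a<m ∷ bs) (na , d) = begin
    Σℤ (λ l → if (a ≡ᵇ l) ∨ mem l xs then F l else 0ℤ) m
      ≡⟨ Σℤ-ext m pointwise ⟩
    Σℤ (λ l → (if a ≡ᵇ l then F l else 0ℤ) + (if mem l xs then F l else 0ℤ)) m
      ≡⟨ Σℤ-+ _ _ m ⟩
    Σℤ (λ l → if a ≡ᵇ l then F l else 0ℤ) m + Σℤ (λ l → if mem l xs then F l else 0ℤ) m
      ≡⟨ cong₂ _+_ (trans (Σℤ-single m a a<m (λ k _ k≢a → cong (λ b → if b then F k else 0ℤ) (eqb-≢ a k (λ e → k≢a (sym e))))) (cong (λ b → if b then F a else 0ℤ) (eqb-refl a))) (Σℤ-membership xs F m bs d) ⟩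
    F a + sumOver F xs ∎
    where
    open ≡-Reasoning
    pointwise : ∀ l → (if (a ≡ᵇ l) ∨ mem l xs then F l else 0ℤ) ≡ (if a ≡ᵇ l then F l else 0ℤ) + (if mem l xs then F l else 0ℤ)
    pointwise l with a ≡ᵇ l in e
    ... | true rewrite sym (eqb-≡ a l e) | mem-false xs na = sym (+-identityʳ (F a))
    ... | false = sym (+-identityˡ _)

  popDepths-sum : ∀ (φ : ℕ → ℤ) rest → Distinct rest → sumOver (λ l → φ (length (popTo l rest))) rest ≡ Σℤ (λ r → φ (suc r)) (length rest)
  popDepths-sum φ [] tt = refl
  popDepths-sum φ (a ∷ r) (na , d) = begin
    φ (length (popTo a (a ∷ r))) + sumOver (λ l → φ (length (popTo l (a ∷ r)))) r
      ≡⟨ cong₂ _+_ (cong (λ b → φ (length (if b then a ∷ r else popTo a r))) (eqb-refl a))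
                   (sumOver-cong r (All.map (λ {l} l≢a → cong (λ b → φ (length (if b then a ∷ r else popTo l r))) (eqb-≢ a l (λ e → l≢a (sym e)))) na)) ⟩
    φ (suc (length r)) + sumOver (λ l → φ (length (popTo l r))) r
      ≡⟨ cong (λ z → φ (suc (length r)) + z) (popDepths-sum φ r d) ⟩
    φ (suc (length r)) + Σℤ (λ r → φ (suc r)) (length r)
      ≡⟨ +-comm (φ (suc (length r))) (Σℤ (λ r → φ (suc r)) (length r)) ⟩
    Σℤ (λ r → φ (suc r)) (suc (length r)) ∎
    where open ≡-Reasoning

  module _ (x y : ℤ) where

    stackWeight : (ℕ → ℤ) → List ℕ → ℤ
    stackWeight φ t = weight x y t * φ (length (openStack t))

    ncWeight : (ℕ → ℤ) → List ℕ × ℕ → ℤ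
    ncWeight φ p = if isNC (proj₁ p) then stackWeight φ (proj₁ p) else 0ℤ

    -- Appending to a noncrossing partition with d open blocks: a new block
    -- (depth d+1), the block on top (covering arc, weight y, depth d), or the block
    -- at depth r+1 < d (weight x, depth r+1).
    stepNC : (ℕ → ℤ) → ℕ → ℤ
    stepNC φ d = φ (suc d) + y * φ d + x * Σℤ (λ r → φ (suc r)) (d ∸ 1)

    module _ {n s m} (I : GrowthInv n s m) (L : LastLabel s m) where
      open GrowthInv I

      -- If s has a crossing, so has every extension, and both sides vanish.
      extend-crossing : ∀ φ → isNC s ≡ false → extendSum (ncWeight φ) (s , m) ≡ ncWeight (stepNC φ) (s , m)
      extend-crossing φ e = trans (extendSum-split (ncWeight φ) s m) (trans
        (cong₂ _+_ (Σℤ-zero m (λ l _ → cong (λ b → if b then stackWeight φ (s ++ l ∷ []) else 0ℤ) (trans (isNC-snoc s l) (cong (_∧ canJoin s l) e))))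
                   (cong (λ b → if b then stackWeight φ (s ++ m ∷ []) else 0ℤ) (trans (isNC-snoc s m) (cong (_∧ canJoin s m) e))))
        (sym (cong (λ b → if b then weight x y s * stepNC φ (length (openStack s)) else 0ℤ) e)))

      -- The extensions of a noncrossing s, whose stack is d ∷ rest with d the last
      -- letter: the open blocks can be joined, the others would create a crossing.
      module NoncrossingExtension (nc : isNC s ≡ true) (φ : ℕ → ℤ) where
        N : StackInv s m
        N = nci nc
        stack : List ℕ
        stack = openStack s
        W : ℤ
        W = weight x y s
        d : ℕ
        d = LastLabel.d L
        rest : List ℕ
        rest = proj₁ (LastLabel.hd L nc)
        stack≡ : stack ≡ d ∷ rest
        stack≡ = proj₂ (LastLabel.hd L nc)

        joinWeight : ℕ → ℤ
        joinWeight l = W * (if d ≡ᵇ l then y else x) * φ (length (popTo l stack))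

        extend-old : ∀ l → l < m → ncWeight φ ((s ++ l ∷ []) , m) ≡ (if mem l stack then joinWeight l else 0ℤ)
        extend-old l l<m = by-membership (mem l stack) refl
          where
          nc≡mem : isNC (s ++ l ∷ []) ≡ mem l stack
          nc≡mem = trans (isNC-snoc s l) (trans (cong (_∧ canJoin s l) nc) (StackInv.jn≡ N l l<m))
          by-membership : ∀ t → mem l stack ≡ t → ncWeight φ ((s ++ l ∷ []) , m) ≡ (if t then joinWeight l else 0ℤ)
          by-membership false q = cong (λ b → if b then stackWeight φ (s ++ l ∷ []) else 0ℤ) (trans nc≡mem q)
          by-membership true q = trans (cong (λ b → if b then stackWeight φ (s ++ l ∷ []) else 0ℤ) (trans nc≡mem q))
            (cong₂ _*_ (weight-old x y I L l l<m) (cong (λ z → φ (length z)) (trans (openStack-snoc s l) (cong (λ b → if b then popTo l stack else l ∷ stack) q))))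

        extend-new : ncWeight φ ((s ++ m ∷ []) , suc m) ≡ W * φ (suc (length stack))
        extend-new = trans
          (cong (λ b → if b then stackWeight φ (s ++ m ∷ []) else 0ℤ) (trans (isNC-snoc s m) (trans (cong (_∧ canJoin s m) nc) (cong (λ o → not (o ∧ coveredLast s m)) (trans (occ≡ m) (ltb-false m m ℕP.≤-refl))))))
          (cong₂ _*_ (weight-new x y I) (cong (λ z → φ (length z)) (trans (openStack-snoc s m) (cong (λ b → if b then popTo m stack else m ∷ stack) m∉stack))))
          where
          m∉stack : mem m stack ≡ false
          m∉stack = mem-false stack (All.map (λ lt eq → ℕP.<-irrefl eq lt) (StackInv.bnd N))

        joinWeight-top : joinWeight d ≡ W * y * φ (suc (length rest))
        joinWeight-top = cong₂ (λ b z → W * (if b then y else x) * φ (length z)) (eqb-refl d)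
          (trans (cong (popTo d) stack≡) (cong (λ b → if b then d ∷ rest else popTo d rest) (eqb-refl d)))

        joinWeight-rest : sumOver joinWeight rest ≡ W * x * Σℤ (λ r → φ (suc r)) (length rest)
        joinWeight-rest = trans (sumOver-cong rest (All.map below-top (proj₁ distinct)))
          (trans (sumOver-* (W * x) (λ l → φ (length (popTo l rest))) rest) (cong ((W * x) *_) (popDepths-sum φ rest (proj₂ distinct))))
          where
          distinct : All (λ b → b ≢ d) rest × Distinct rest
          distinct = subst Distinct stack≡ (SortedBy⇒Distinct stack (StackInv.srt N))
          below-top : ∀ {l} → l ≢ d → joinWeight l ≡ W * x * φ (length (popTo l rest))
          below-top {l} l≢d = cong₂ (λ b z → W * (if b then y else x) * φ (length z)) (eqb-≢ d l (λ q → l≢d (sym q)))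
            (trans (cong (popTo l) stack≡) (cong (λ b → if b then d ∷ rest else popTo l rest) (eqb-≢ d l (λ q → l≢d (sym q)))))

        extend-noncrossing : extendSum (ncWeight φ) (s , m) ≡ ncWeight (stepNC φ) (s , m)
        extend-noncrossing = begin
          extendSum (ncWeight φ) (s , m)
            ≡⟨ extendSum-split (ncWeight φ) s m ⟩
          Σℤ (λ l → ncWeight φ ((s ++ l ∷ []) , m)) m + ncWeight φ ((s ++ m ∷ []) , suc m)
            ≡⟨ cong₂ _+_ (Σℤ-cong m extend-old) extend-new ⟩
          Σℤ (λ l → if mem l stack then joinWeight l else 0ℤ) m + W * φ (suc (length stack))
            ≡⟨ cong (_+ W * φ (suc (length stack))) (Σℤ-membership stack joinWeight m (StackInv.bnd N) (SortedBy⇒Distinct stack (StackInv.srt N))) ⟩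
          sumOver joinWeight stack + W * φ (suc (length stack))
            ≡⟨ cong (λ z → sumOver joinWeight z + W * φ (suc (length z))) stack≡ ⟩
          (joinWeight d + sumOver joinWeight rest) + W * φ (suc (suc (length rest)))
            ≡⟨ cong₂ (λ a b → (a + b) + W * φ (suc (suc (length rest)))) joinWeight-top joinWeight-rest ⟩
          (W * y * φ (suc (length rest)) + W * x * Σℤ (λ r → φ (suc r)) (length rest)) + W * φ (suc (suc (length rest)))
            ≡⟨ regroup W x y (φ (suc (length rest))) (Σℤ (λ r → φ (suc r)) (length rest)) (φ (suc (suc (length rest)))) ⟩
          W * stepNC φ (suc (length rest))
            ≡⟨ cong (λ z → W * stepNC φ (length z)) (sym stack≡) ⟩
          W * stepNC φ (length stack)
            ≡⟨ cong (λ b → if b then W * stepNC φ (length stack) else 0ℤ) (sym nc) ⟩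
          ncWeight (stepNC φ) (s , m) ∎
          where
          open ≡-Reasoning
          regroup : ∀ W x y a S b → (W * y * a + W * x * S) + W * b ≡ W * (b + y * a + x * S)
          regroup = solve-∀

      extend-nc : ∀ φ → extendSum (ncWeight φ) (s , m) ≡ ncWeight (stepNC φ) (s , m)
      extend-nc φ = by-cases (isNC s) refl
        where
        by-cases : ∀ b → isNC s ≡ b → extendSum (ncWeight φ) (s , m) ≡ ncWeight (stepNC φ) (s , m)
        by-cases true nc = NoncrossingExtension.extend-noncrossing nc φ
        by-cases false nc = extend-crossing φ nc

    rgsSum-nc-step : ∀ φ n → 1 ≤ n → rgsSum (ncWeight φ) (suc n) ≡ rgsSum (ncWeight (stepNC φ)) n
    rgsSum-nc-step φ n 1≤n = trans (rgsSum-extend (ncWeight φ) n) (rgsSum-cong n (λ s m I → extend-nc I (lastLabel I 1≤n) φ))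

    rgsSum-nc-1 : ∀ φ → rgsSum (ncWeight φ) 1 ≡ φ 1
    rgsSum-nc-1 φ = trans (+-identityʳ _) (*-identityˡ (φ 1))

    rgsSum-nc-iterate : ∀ k φ → rgsSum (ncWeight φ) (suc k) ≡ iter stepNC k φ 1
    rgsSum-nc-iterate zero φ = rgsSum-nc-1 φ
    rgsSum-nc-iterate (suc k) φ = trans (rgsSum-nc-step φ (suc k) (s≤s z≤n)) (rgsSum-nc-iterate k (stepNC φ))

    stepNC-cong : ∀ {f g : ℕ → ℤ} → (∀ p → f p ≡ g p) → ∀ p → stepNC f p ≡ stepNC g p
    stepNC-cong e p = cong₂ _+_ (cong₂ _+_ (e (suc p)) (cong (y *_) (e p))) (cong (x *_) (Σℤ-ext (p ∸ 1) (λ r → e (suc r))))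

    stepNC-lin : ∀ (f g : ℕ → ℤ) (k : ℤ) p → stepNC (λ q → f q + k * g q) p ≡ stepNC f p + k * stepNC g p
    stepNC-lin f g k p = trans (cong (λ z → f (suc p) + k * g (suc p) + y * (f p + k * g p) + x * z) (trans (Σℤ-+ _ _ (p ∸ 1)) (cong (λ z → Σℤ (λ r → f (suc r)) (p ∸ 1) + z) (Σℤ-* k _ (p ∸ 1)))))
                           (algebra (f (suc p)) (g (suc p)) (f p) (g p) k y x (Σℤ (λ r → f (suc r)) (p ∸ 1)) (Σℤ (λ r → g (suc r)) (p ∸ 1)))
      where algebra : ∀ a b c d k y x S T → a + k * b + y * (c + k * d) + x * (S + k * T) ≡ a + y * c + x * S + k * (b + y * d + x * T)
            algebra = solve-∀

    𝓝-iterate : ∀ k → 𝓝 (suc k) x y ≡ iter stepNC k (λ _ → 1ℤ) 1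
    𝓝-iterate k = trans (sumℤ-filter isNC (weight x y) (rgs (suc k))) (rgsSum-nc-iterate k (λ _ → 1ℤ))


-- The binomial transform of the iterates of a linear operator A is an iterate
-- of A - u.
module BinomialTransform where

  open import Data.Nat as ℕ using (ℕ; zero; suc; _<_; s≤s; _∸_)
  import Data.Nat.Properties as ℕP
  open import Data.Integer as ℤ using (ℤ; +_; -[1+_]; _+_; _*_; -_; _-_; 0ℤ; _^_)
  open import Data.Integer.Properties using (+-identityʳ; +-identityˡ; *-identityˡ; *-zeroˡ)
  open import Data.Integer.Tactic.RingSolver
  open import Relation.Binary.PropositionalEquality
  open import Relation.Nullary using (yes; no)
  open IntSums
  open Binomial

  coeff : ℤ → ℕ → ℕ → ℤ
  coeff u n k = (-[1+ 0 ] ^ (n ∸ k)) * (+ bin n k) * (u ^ (n ∸ k))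

  ∸-suc : ∀ n k → k < n → n ∸ k ≡ suc (n ∸ suc k)
  ∸-suc (suc n) zero _ = refl
  ∸-suc (suc n) (suc k) (s≤s k<n) = ∸-suc n k k<n

  coeff-succ : ∀ u n k → coeff u (suc n) (suc k) ≡ coeff u n k - u * coeff u n (suc k)
  coeff-succ u n k with k ℕP.<? n
  ... | yes k<n rewrite ∸-suc n k k<n = algebra (-[1+ 0 ] ^ (n ∸ suc k)) (+ bin n k) (+ bin n (suc k)) u (u ^ (n ∸ suc k))
    where algebra : ∀ s a b u p → (-[1+ 0 ] * s) * (a + b) * (u * p) ≡ (-[1+ 0 ] * s) * a * (u * p) - u * (s * b * p)
          algebra = solve-∀
  ... | no k≮n rewrite bin-over n (suc k) (s≤s (ℕP.≮⇒≥ k≮n)) =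
    algebra (-[1+ 0 ] ^ (n ∸ k)) (+ bin n k) (u ^ (n ∸ k)) u (-[1+ 0 ] ^ (n ∸ suc k)) (u ^ (n ∸ suc k))
    where algebra : ∀ s a p u s' p' → s * (a + + 0) * p ≡ s * a * p - u * (s' * + 0 * p')
          algebra = solve-∀

  coeff-zero : ∀ u n → coeff u (suc n) 0 ≡ - (u * coeff u n 0)
  coeff-zero u n rewrite bin-0 n = algebra (-[1+ 0 ] ^ n) (u ^ n) u
    where algebra : ∀ s p u → (-[1+ 0 ] * s) * + 1 * (u * p) ≡ - (u * (s * + 1 * p))
          algebra = solve-∀

  coeff-over : ∀ u n → coeff u n (suc n) ≡ 0ℤ
  coeff-over u n rewrite bin-over n (suc n) ℕP.≤-refl = algebra (-[1+ 0 ] ^ (n ∸ suc n)) (u ^ (n ∸ suc n))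
    where algebra : ∀ s p → s * + 0 * p ≡ 0ℤ
          algebra = solve-∀

  transform-step : ∀ u n (a : ℕ → ℤ) → Σℤ (λ k → coeff u (suc n) k * a k) (suc (suc n)) ≡ Σℤ (λ k → coeff u n k * a (suc k)) (suc n) - u * Σℤ (λ k → coeff u n k * a k) (suc n)
  transform-step u n a = begin
    Σℤ (λ k → coeff u (suc n) k * a k) (suc (suc n))
      ≡⟨ Σℤ-front _ (suc n) ⟩
    coeff u (suc n) 0 * a 0 + Σℤ (λ k → coeff u (suc n) (suc k) * a (suc k)) (suc n)
      ≡⟨ cong₂ _+_ (cong (_* a 0) (coeff-zero u n)) (Σℤ-ext (suc n) (λ k → trans (cong (_* a (suc k)) (coeff-succ u n k)) (pointwise (coeff u n k) (coeff u n (suc k)) (a (suc k)) u))) ⟩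
    - (u * coeff u n 0) * a 0 + Σℤ (λ k → coeff u n k * a (suc k) + (- u) * (coeff u n (suc k) * a (suc k))) (suc n)
      ≡⟨ cong (λ z → - (u * coeff u n 0) * a 0 + z) (trans (Σℤ-+ _ _ (suc n)) (cong (λ z → Σℤ (λ k → coeff u n k * a (suc k)) (suc n) + z) (Σℤ-* (- u) _ (suc n)))) ⟩
    - (u * coeff u n 0) * a 0 + (X + (- u) * Y)
      ≡⟨ regroup (u) (coeff u n 0) (a 0) X Y ⟩
    X - u * (coeff u n 0 * a 0 + Y)
      ≡⟨ cong (λ z → X - u * z) (sym (Σℤ-front (λ k → coeff u n k * a k) (suc n))) ⟩
    X - u * Σℤ (λ k → coeff u n k * a k) (suc (suc n))
      ≡⟨ cong (λ z → X - u * z) (trans (cong (λ z → Σℤ (λ k → coeff u n k * a k) (suc n) + z) (trans (cong (_* a (suc n)) (coeff-over u n)) (*-zeroˡ (a (suc n))))) (+-identityʳ (Σℤ (λ k → coeff u n k * a k) (suc n)))) ⟩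
    X - u * Σℤ (λ k → coeff u n k * a k) (suc n) ∎
    where
    open ≡-Reasoning
    X : ℤ
    X = Σℤ (λ k → coeff u n k * a (suc k)) (suc n)
    Y : ℤ
    Y = Σℤ (λ k → coeff u n (suc k) * a (suc k)) (suc n)
    pointwise : ∀ p q a u → (p - u * q) * a ≡ p * a + (- u) * (q * a)
    pointwise = solve-∀
    regroup : ∀ u c0 a0 X Y → - (u * c0) * a0 + (X + (- u) * Y) ≡ X - u * (c0 * a0 + Y)
    regroup = solve-∀

  module Transform (A : (ℕ → ℤ) → ℕ → ℤ)
            (A-cong : ∀ {f g : ℕ → ℤ} → (∀ p → f p ≡ g p) → ∀ p → A f p ≡ A g p)
            (A-lin : ∀ (f g : ℕ → ℤ) (k : ℤ) p → A (λ q → f q + k * g q) p ≡ A f p + k * A g p)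
            (u : ℤ) where

    shifted : (ℕ → ℤ) → ℕ → ℤ
    shifted φ p = A φ p - u * φ p

    iterShifted-cong : ∀ n {f g : ℕ → ℤ} → (∀ p → f p ≡ g p) → ∀ p → iter shifted n f p ≡ iter shifted n g p
    iterShifted-cong zero e p = e p
    iterShifted-cong (suc n) {f} {g} e p = iterShifted-cong n (λ q → cong₂ _-_ (A-cong e q) (cong (u *_) (e q))) p

    iterShifted-lin : ∀ n (f g : ℕ → ℤ) (k : ℤ) p → iter shifted n (λ q → f q + k * g q) p ≡ iter shifted n f p + k * iter shifted n g p
    iterShifted-lin zero f g k p = refl
    iterShifted-lin (suc n) f g k p = trans (iterShifted-cong n (λ q → trans (cong (_- u * (f q + k * g q)) (A-lin f g k q)) (algebra (A f q) (A g q) (f q) (g q) k u)) p)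
                                      (iterShifted-lin n (shifted f) (shifted g) k p)
      where algebra : ∀ Af Ag fq gq k u → Af + k * Ag - u * (fq + k * gq) ≡ (Af - u * fq) + k * (Ag - u * gq)
            algebra = solve-∀

    transformOf : ℕ → (ℕ → ℤ) → ℕ → ℤ
    transformOf n φ p = Σℤ (λ k → coeff u n k * iter A k φ p) (suc n)

    transform-iterate : ∀ n φ p → transformOf n φ p ≡ iter shifted n φ p
    transform-iterate zero φ p = trans (+-identityˡ _) (*-identityˡ (φ p))
    transform-iterate (suc n) φ p = begin
      transformOf (suc n) φ p
        ≡⟨ transform-step u n (λ k → iter A k φ p) ⟩
      transformOf n (A φ) p - u * transformOf n φ p
        ≡⟨ cong₂ (λ a b → a - u * b) (transform-iterate n (A φ) p) (transform-iterate n φ p) ⟩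
      iter shifted n (A φ) p - u * iter shifted n φ p
        ≡⟨ algebra (iter shifted n (A φ) p) (iter shifted n φ p) u ⟩
      iter shifted n (A φ) p + (- u) * iter shifted n φ p
        ≡⟨ sym (iterShifted-lin n (A φ) φ (- u) p) ⟩
      iter shifted n (λ q → A φ q + (- u) * φ q) p
        ≡⟨ iterShifted-cong n (λ q → sym (algebra (A φ q) (φ q) u)) p ⟩
      iter shifted (suc n) φ p ∎
      where
      open ≡-Reasoning
      algebra : ∀ a b u → a - u * b ≡ a + (- u) * b
      algebra = solve-∀


module FeasibleIntertwining where

  open import Data.Nat as ℕ using (ℕ; zero; suc; _∸_)
  import Data.Nat.Properties as ℕP
  open import Data.Integer as ℤ using (ℤ; +_; -[1+_]; _+_; _*_; -_; _-_; 0ℤ; 1ℤ; _^_)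
  open import Data.Integer.Properties using (*-assoc; +-identityˡ; *-identityˡ; pos-+; pos-*)
  open import Data.Integer.Tactic.RingSolver
  open import Relation.Binary.PropositionalEquality
  open IntSums
  open Binomial
  open BinomialTransform
  open AllPartitions using (stepAll)
  open FeasiblePartitions using (stepFeas; unitAt00)

  Σℤ-combination : ∀ (A B C : ℕ → ℤ) (k x : ℤ) n → Σℤ (λ i → A i + (- 1ℤ) * B i + x * (k * B i + C i)) n ≡ Σℤ A n + (- 1ℤ) * Σℤ B n + x * (k * Σℤ B n + Σℤ C n)
  Σℤ-combination A B C k x zero = algebra k x
    where algebra : ∀ k x → 0ℤ ≡ 0ℤ + (- 1ℤ) * 0ℤ + x * (k * 0ℤ + 0ℤ)
          algebra = solve-∀
  Σℤ-combination A B C k x (suc n) rewrite Σℤ-combination A B C k x n = algebra (Σℤ A n) (Σℤ B n) (Σℤ C n) (A n) (B n) (C n) k x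
    where algebra : ∀ SA SB SC a b c k x → SA + (- 1ℤ) * SB + x * (k * SB + SC) + (a + (- 1ℤ) * b + x * (k * b + c)) ≡ (SA + a) + (- 1ℤ) * (SB + b) + x * (k * (SB + b) + (SC + c))
          algebra = solve-∀

  -- The map φ ↦ feasEmbed φ intertwining the shifted all-partition operator with
  -- the feasible operator: feasEmbed φ j k is the j-th binomial difference of φ
  -- at k+1 (inclusion–exclusion over the j singleton blocks).
  feasEmbed : (ℕ → ℤ) → ℕ → ℕ → ℤ
  feasEmbed φ j k = Σℤ (λ i → coeff 1ℤ j i * φ (suc (k ℕ.+ i))) (suc j)

  coeff1-absorb : ∀ j i → coeff 1ℤ (suc j) (suc i) * + suc i ≡ + suc j * coeff 1ℤ j i
  coeff1-absorb j i = begin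
    (-[1+ 0 ] ^ (j ∸ i)) * (+ bin (suc j) (suc i)) * (1ℤ ^ (j ∸ i)) * + suc i
      ≡⟨ algebra (-[1+ 0 ] ^ (j ∸ i)) (+ bin (suc j) (suc i)) (1ℤ ^ (j ∸ i)) (+ suc i) ⟩
    (-[1+ 0 ] ^ (j ∸ i)) * (+ suc i * + bin (suc j) (suc i)) * (1ℤ ^ (j ∸ i))
      ≡⟨ cong (λ z → (-[1+ 0 ] ^ (j ∸ i)) * z * (1ℤ ^ (j ∸ i))) (trans (sym (pos-* (suc i) (bin (suc j) (suc i)))) (trans (cong +_ (bin-absorb j i)) (pos-* (suc j) (bin j i)))) ⟩
    (-[1+ 0 ] ^ (j ∸ i)) * (+ suc j * + bin j i) * (1ℤ ^ (j ∸ i))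
      ≡⟨ algebra₂ (-[1+ 0 ] ^ (j ∸ i)) (+ suc j) (+ bin j i) (1ℤ ^ (j ∸ i)) ⟩
    + suc j * coeff 1ℤ j i ∎
    where
    open ≡-Reasoning
    algebra : ∀ s b p q → s * b * p * q ≡ s * (q * b) * p
    algebra = solve-∀
    algebra₂ : ∀ s a b p → s * (a * b) * p ≡ a * (s * b * p)
    algebra₂ = solve-∀

  feasEmbed-absorb-term : ∀ (φ : ℕ → ℤ) j k i → + suc j * (coeff 1ℤ j i * φ (suc (suc k ℕ.+ i)))
                                     ≡ coeff 1ℤ (suc j) (suc i) * (+ suc i * φ (suc (k ℕ.+ suc i)))
  feasEmbed-absorb-term φ j k i = begin
    + suc j * (coeff 1ℤ j i * φ (suc (suc k ℕ.+ i)))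
      ≡⟨ sym (*-assoc (+ suc j) (coeff 1ℤ j i) (φ (suc (suc k ℕ.+ i)))) ⟩
    + suc j * coeff 1ℤ j i * φ (suc (suc k ℕ.+ i))
      ≡⟨ cong₂ _*_ (sym (coeff1-absorb j i)) (cong (λ z → φ (suc z)) (sym (ℕP.+-suc k i))) ⟩
    coeff 1ℤ (suc j) (suc i) * + suc i * φ (suc (k ℕ.+ suc i))
      ≡⟨ *-assoc (coeff 1ℤ (suc j) (suc i)) (+ suc i) (φ (suc (k ℕ.+ suc i))) ⟩
    coeff 1ℤ (suc j) (suc i) * (+ suc i * φ (suc (k ℕ.+ suc i))) ∎
    where open ≡-Reasoning

  feasEmbed-absorb : ∀ φ j k → + j * feasEmbed φ (j ∸ 1) (suc k) ≡ Σℤ (λ i → coeff 1ℤ j i * (+ i * φ (suc (k ℕ.+ i)))) (suc j)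
  feasEmbed-absorb φ zero k = algebra (feasEmbed φ 0 (suc k)) (coeff 1ℤ 0 0) (φ (suc (k ℕ.+ 0)))
    where algebra : ∀ a b c → + 0 * a ≡ 0ℤ + b * (+ 0 * c)
          algebra = solve-∀
  feasEmbed-absorb φ (suc j) k = begin
    + suc j * Σℤ (λ i → coeff 1ℤ j i * φ (suc (suc k ℕ.+ i))) (suc j)
      ≡⟨ sym (Σℤ-* (+ suc j) (λ i → coeff 1ℤ j i * φ (suc (suc k ℕ.+ i))) (suc j)) ⟩
    Σℤ (λ i → + suc j * (coeff 1ℤ j i * φ (suc (suc k ℕ.+ i)))) (suc j)
      ≡⟨ Σℤ-ext (suc j) (feasEmbed-absorb-term φ j k) ⟩
    Σℤ (λ i → coeff 1ℤ (suc j) (suc i) * (+ suc i * φ (suc (k ℕ.+ suc i)))) (suc j)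
      ≡⟨ sym (+-identityˡ (Σℤ (λ i → coeff 1ℤ (suc j) (suc i) * (+ suc i * φ (suc (k ℕ.+ suc i)))) (suc j))) ⟩
    0ℤ + Σℤ (λ i → coeff 1ℤ (suc j) (suc i) * (+ suc i * φ (suc (k ℕ.+ suc i)))) (suc j)
      ≡⟨ cong (_+ Σℤ (λ i → coeff 1ℤ (suc j) (suc i) * (+ suc i * φ (suc (k ℕ.+ suc i)))) (suc j)) (sym (algebra (coeff 1ℤ (suc j) 0) (φ (suc (k ℕ.+ 0))))) ⟩
    coeff 1ℤ (suc j) 0 * (+ 0 * φ (suc (k ℕ.+ 0))) + Σℤ (λ i → coeff 1ℤ (suc j) (suc i) * (+ suc i * φ (suc (k ℕ.+ suc i)))) (suc j)
      ≡⟨ sym (Σℤ-front (λ i → coeff 1ℤ (suc j) i * (+ i * φ (suc (k ℕ.+ i)))) (suc j)) ⟩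
    Σℤ (λ i → coeff 1ℤ (suc j) i * (+ i * φ (suc (k ℕ.+ i)))) (suc (suc j)) ∎
    where
    open ≡-Reasoning
    algebra : ∀ b c → b * (+ 0 * c) ≡ 0ℤ
    algebra = solve-∀

  module _ (x y : ℤ) where

    u : ℤ
    u = y + + 1

    shiftedAll : (ℕ → ℤ) → ℕ → ℤ
    shiftedAll φ p = stepAll x y φ p - u * φ p

    feasEmbed-intertwines : ∀ φ j k → stepFeas x (feasEmbed φ) j k ≡ feasEmbed (shiftedAll φ) j k
    feasEmbed-intertwines φ j k = begin
      feasEmbed φ (suc j) k + x * (+ j * feasEmbed φ (j ∸ 1) (suc k) + + k * feasEmbed φ j k)
        ≡⟨ cong₂ (λ a b → a + x * (b + + k * feasEmbed φ j k)) (transform-step 1ℤ j (λ i → φ (suc (k ℕ.+ i)))) (feasEmbed-absorb φ j k) ⟩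
      (S2 - 1ℤ * S1) + x * (Sabs + + k * S1)
        ≡⟨ algebra₁ S2 S1 Sabs (+ k) x ⟩
      S2 + (- 1ℤ) * S1 + x * (+ k * S1 + Sabs)
        ≡⟨ sym (Σℤ-combination (λ i → coeff 1ℤ j i * φ (suc (k ℕ.+ suc i))) (λ i → coeff 1ℤ j i * φ (suc (k ℕ.+ i))) (λ i → coeff 1ℤ j i * (+ i * φ (suc (k ℕ.+ i)))) (+ k) x (suc j)) ⟩
      Σℤ (λ i → coeff 1ℤ j i * φ (suc (k ℕ.+ suc i)) + (- 1ℤ) * (coeff 1ℤ j i * φ (suc (k ℕ.+ i))) + x * (+ k * (coeff 1ℤ j i * φ (suc (k ℕ.+ i))) + coeff 1ℤ j i * (+ i * φ (suc (k ℕ.+ i))))) (suc j)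
        ≡⟨ Σℤ-ext (suc j) pointwise ⟩
      feasEmbed (shiftedAll φ) j k ∎
      where
      open ≡-Reasoning
      S1 : ℤ
      S1 = feasEmbed φ j k
      S2 : ℤ
      S2 = Σℤ (λ i → coeff 1ℤ j i * φ (suc (k ℕ.+ suc i))) (suc j)
      Sabs : ℤ
      Sabs = Σℤ (λ i → coeff 1ℤ j i * (+ i * φ (suc (k ℕ.+ i)))) (suc j)
      algebra₁ : ∀ S2 S1 Sa k x → (S2 - 1ℤ * S1) + x * (Sa + k * S1) ≡ S2 + (- 1ℤ) * S1 + x * (k * S1 + Sa)
      algebra₁ = solve-∀
      algebra₂ : ∀ e p2 p1 k i x y → e * p2 + (- 1ℤ) * (e * p1) + x * (k * (e * p1) + e * (i * p1)) ≡ e * (p2 + (y + (k + i) * x) * p1 - (y + + 1) * p1)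
      algebra₂ = solve-∀
      pointwise : ∀ i → coeff 1ℤ j i * φ (suc (k ℕ.+ suc i)) + (- 1ℤ) * (coeff 1ℤ j i * φ (suc (k ℕ.+ i))) + x * (+ k * (coeff 1ℤ j i * φ (suc (k ℕ.+ i))) + coeff 1ℤ j i * (+ i * φ (suc (k ℕ.+ i)))) ≡ coeff 1ℤ j i * shiftedAll φ (suc (k ℕ.+ i))
      pointwise i = trans (cong (λ z → coeff 1ℤ j i * φ (suc z) + (- 1ℤ) * (coeff 1ℤ j i * φ (suc (k ℕ.+ i))) + x * (+ k * (coeff 1ℤ j i * φ (suc (k ℕ.+ i))) + coeff 1ℤ j i * (+ i * φ (suc (k ℕ.+ i))))) (ℕP.+-suc k i))
             (trans (algebra₂ (coeff 1ℤ j i) (φ (suc (suc (k ℕ.+ i)))) (φ (suc (k ℕ.+ i))) (+ k) (+ i) x y)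
                    (cong (λ z → coeff 1ℤ j i * (φ (suc (suc (k ℕ.+ i))) + (y + z * x) * φ (suc (k ℕ.+ i)) - (y + + 1) * φ (suc (k ℕ.+ i)))) (sym (pos-+ k i))))

    stepFeas-cong : ∀ {ψ ψ' : ℕ → ℕ → ℤ} → (∀ j k → ψ j k ≡ ψ' j k) → ∀ j k → stepFeas x ψ j k ≡ stepFeas x ψ' j k
    stepFeas-cong e j k = cong₂ _+_ (e (suc j) k) (cong (x *_) (cong₂ _+_ (cong (+ j *_) (e (j ∸ 1) (suc k))) (cong (+ k *_) (e j k))))

    iterFeas-cong : ∀ n {ψ ψ' : ℕ → ℕ → ℤ} → (∀ j k → ψ j k ≡ ψ' j k) → ∀ j k → iter (stepFeas x) n ψ j k ≡ iter (stepFeas x) n ψ' j k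
    iterFeas-cong zero e j k = e j k
    iterFeas-cong (suc n) e j k = iterFeas-cong n (stepFeas-cong e) j k

    feasEmbed-intertwines-iter : ∀ n φ j k → iter (stepFeas x) n (feasEmbed φ) j k ≡ feasEmbed (iter shiftedAll n φ) j k
    feasEmbed-intertwines-iter zero φ j k = refl
    feasEmbed-intertwines-iter (suc n) φ j k = trans (iterFeas-cong n (feasEmbed-intertwines φ) j k) (feasEmbed-intertwines-iter n (shiftedAll φ) j k)

  -- The binomial differences of a constant vanish, so feasEmbed 1 = unitAt00.
  feasEmbed-const : ∀ j k → feasEmbed (λ _ → 1ℤ) j k ≡ unitAt00 j k
  feasEmbed-const zero k = refl
  feasEmbed-const (suc j) k = trans (transform-step 1ℤ j (λ _ → 1ℤ)) (algebra (Σℤ (λ i → coeff 1ℤ j i * 1ℤ) (suc j)))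
    where algebra : ∀ a → a - 1ℤ * a ≡ 0ℤ
          algebra = solve-∀

  feasEmbed-at00 : ∀ φ → feasEmbed φ 0 0 ≡ φ 1
  feasEmbed-at00 φ = trans (+-identityˡ _) (*-identityˡ (φ 1))


-- A weighted walk on heights e ∈ ℕ: an up-step has weight 1, a down-step
-- weight x.  `ballotWalk n e` is the total weight of the walks of length n from
-- height e down to height 0; its values are x-powers times ballot numbers, and
-- in particular `ballotWalk n 0` is x^m Cₘ when n = 2m and 0 when n is odd.
module BallotWalk (x : ℤ) where

  open import Data.Nat as ℕ using (ℕ; zero; suc; _<_; s≤s)
  import Data.Nat.Properties as ℕP
  open import Data.Nat.Tactic.RingSolver using () renaming (solve-∀ to ℕ-solve-∀)
  open import Data.Integer as ℤ using (ℤ; +_; _+_; _*_; 0ℤ; _^_)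
  open import Data.Integer.Properties using (pos-+)
  open import Data.Integer.Tactic.RingSolver
  open import Relation.Binary.PropositionalEquality
  open IntSums
  open Binomial

  2[1+k]≡2+2k : ∀ k → 2 ℕ.* suc k ≡ suc (1 ℕ.+ 2 ℕ.* k)
  2[1+k]≡2+2k = ℕ-solve-∀
  2[1+k]≡1+2k+1 : ∀ k → 2 ℕ.* suc k ≡ 1 ℕ.+ 2 ℕ.* k ℕ.+ 1
  2[1+k]≡1+2k+1 = ℕ-solve-∀
  e+2[1+k]≡[2+e]+2k : ∀ e k → e ℕ.+ 2 ℕ.* suc k ≡ suc (suc e) ℕ.+ 2 ℕ.* k
  e+2[1+k]≡[2+e]+2k = ℕ-solve-∀
  [2+e]+k≡1+[e+[1+k]] : ∀ e k → suc (suc e) ℕ.+ k ≡ suc (e ℕ.+ suc k)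
  [2+e]+k≡1+[e+[1+k]] = ℕ-solve-∀
  e+2k+1≡1+[e+2k] : ∀ e k → e ℕ.+ 2 ℕ.* k ℕ.+ 1 ≡ suc (e ℕ.+ 2 ℕ.* k)
  e+2k+1≡1+[e+2k] = ℕ-solve-∀
  [1+e]+2[1+k]≡[2+e]+2k+1 : ∀ e k → suc e ℕ.+ 2 ℕ.* suc k ≡ suc (suc e) ℕ.+ 2 ℕ.* k ℕ.+ 1
  [1+e]+2[1+k]≡[2+e]+2k+1 = ℕ-solve-∀
  [1+e]+2k≡e+2k+1 : ∀ e k → suc e ℕ.+ 2 ℕ.* k ≡ e ℕ.+ 2 ℕ.* k ℕ.+ 1
  [1+e]+2k≡e+2k+1 = ℕ-solve-∀

  zero-step : ∀ x → 0ℤ + x * 0ℤ ≡ 0ℤ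
  zero-step = solve-∀

  ballotStep : (ℕ → ℤ) → ℕ → ℤ
  ballotStep ψ zero = ψ 1
  ballotStep ψ (suc e) = ψ (suc (suc e)) + x * ψ e

  ballotWalk : ℕ → ℕ → ℤ
  ballotWalk n = iter ballotStep n unitAt0

  ballotWalk-suc : ∀ n e → ballotWalk (suc n) e ≡ ballotStep (ballotWalk n) e
  ballotWalk-suc n e = cong (λ ψ → ψ e) (iter-suc ballotStep n unitAt0)

  record BallotValues (n : ℕ) : Set where
    field
      vanish : ∀ e → n < e → ballotWalk n e ≡ 0ℤ
      even   : ∀ e k → n ≡ e ℕ.+ 2 ℕ.* k → ballotWalk n e ≡ x ^ (e ℕ.+ k) * + ballot k e
      odd    : ∀ e k → n ≡ e ℕ.+ 2 ℕ.* k ℕ.+ 1 → ballotWalk n e ≡ 0ℤ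

  ballotValues-zero : BallotValues 0
  ballotValues-zero = record { vanish = vanish ; even = even ; odd = odd }
    where
    vanish : ∀ e → 0 < e → ballotWalk 0 e ≡ 0ℤ
    vanish (suc e) _ = refl
    even : ∀ e k → 0 ≡ e ℕ.+ 2 ℕ.* k → ballotWalk 0 e ≡ x ^ (e ℕ.+ k) * + ballot k e
    even zero zero _ = refl
    even zero (suc k) ()
    even (suc e) k ()
    odd : ∀ e k → 0 ≡ e ℕ.+ 2 ℕ.* k ℕ.+ 1 → ballotWalk 0 e ≡ 0ℤ
    odd e k eq with trans eq (e+2k+1≡1+[e+2k] e k)
    ... | ()

  module _ {n : ℕ} (V : BallotValues n) where
    open BallotValues V

    private
      step-at : ∀ e {a b} → ballotWalk n (suc (suc e)) ≡ a → ballotWalk n e ≡ b →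
                ballotWalk (suc n) (suc e) ≡ a + x * b
      step-at e p q = trans (ballotWalk-suc n (suc e)) (cong₂ (λ a b → a + x * b) p q)

    ballotValues-vanish : ∀ e → suc n < e → ballotWalk (suc n) e ≡ 0ℤ
    ballotValues-vanish (suc e) (s≤s n<e) =
      trans (step-at e (vanish (suc (suc e)) (ℕP.m<n⇒m<1+n (ℕP.m<n⇒m<1+n n<e))) (vanish e n<e)) (zero-step x)

    -- Pascal's rule for ballot numbers, ballot (k+1) (e+1) = ballot k (e+2) + ballot (k+1) e,
    -- matches the two ways of leaving height e+1.
    ballotValues-even : ∀ e k → suc n ≡ e ℕ.+ 2 ℕ.* k → ballotWalk (suc n) e ≡ x ^ (e ℕ.+ k) * + ballot k e
    ballotValues-even zero zero ()
    ballotValues-even zero (suc k) eq =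
      trans (ballotWalk-suc n 0) (even 1 k (ℕP.suc-injective (trans eq (2[1+k]≡2+2k k))))
    ballotValues-even (suc e) zero eq = trans (step-at e above (even e 0 n≡)) (algebra x (x ^ (e ℕ.+ 0)))
      where
      n≡ : n ≡ e ℕ.+ 2 ℕ.* 0
      n≡ = ℕP.suc-injective eq
      above : ballotWalk n (suc (suc e)) ≡ 0ℤ
      above = vanish (suc (suc e)) (ℕP.m<n⇒m<1+n (s≤s (ℕP.≤-reflexive (trans n≡ (ℕP.+-identityʳ e)))))
      algebra : ∀ x p → 0ℤ + x * (p * + 1) ≡ (x * p) * + 1
      algebra = solve-∀
    ballotValues-even (suc e) (suc k) eq = begin
      ballotWalk (suc n) (suc e)
        ≡⟨ step-at e (even (suc (suc e)) k (trans n≡ (e+2[1+k]≡[2+e]+2k e k))) (even e (suc k) n≡) ⟩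
      x ^ (suc (suc e) ℕ.+ k) * + ballot k (suc (suc e)) + x * (x ^ (e ℕ.+ suc k) * + ballot (suc k) e)
        ≡⟨ cong (λ z → x ^ z * + ballot k (suc (suc e)) + x * (x ^ (e ℕ.+ suc k) * + ballot (suc k) e)) ([2+e]+k≡1+[e+[1+k]] e k) ⟩
      (x * x ^ (e ℕ.+ suc k)) * + ballot k (suc (suc e)) + x * (x ^ (e ℕ.+ suc k) * + ballot (suc k) e)
        ≡⟨ algebra x (x ^ (e ℕ.+ suc k)) (+ ballot k (suc (suc e))) (+ ballot (suc k) e) ⟩
      (x * x ^ (e ℕ.+ suc k)) * (+ ballot k (suc (suc e)) + + ballot (suc k) e)
        ≡⟨ cong ((x * x ^ (e ℕ.+ suc k)) *_) (sym (pos-+ (ballot k (suc (suc e))) (ballot (suc k) e))) ⟩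
      x ^ (suc e ℕ.+ suc k) * + ballot (suc k) (suc e) ∎
      where
      open ≡-Reasoning
      n≡ : n ≡ e ℕ.+ 2 ℕ.* suc k
      n≡ = ℕP.suc-injective eq
      algebra : ∀ x p a b → (x * p) * a + x * (p * b) ≡ (x * p) * (a + b)
      algebra = solve-∀

    ballotValues-odd : ∀ e k → suc n ≡ e ℕ.+ 2 ℕ.* k ℕ.+ 1 → ballotWalk (suc n) e ≡ 0ℤ
    ballotValues-odd zero zero eq =
      trans (ballotWalk-suc n 0) (vanish 1 (s≤s (ℕP.≤-reflexive (ℕP.suc-injective (trans eq (e+2k+1≡1+[e+2k] 0 0))))))
    ballotValues-odd zero (suc k) eq =
      trans (ballotWalk-suc n 0) (odd 1 k (trans (ℕP.suc-injective (trans eq (e+2k+1≡1+[e+2k] 0 (suc k)))) (2[1+k]≡1+2k+1 k)))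
    ballotValues-odd (suc e) k eq = trans (step-at e (above k refl) (odd e k (trans n≡ ([1+e]+2k≡e+2k+1 e k)))) (zero-step x)
      where
      n≡ : n ≡ suc e ℕ.+ 2 ℕ.* k
      n≡ = ℕP.suc-injective (trans eq (e+2k+1≡1+[e+2k] (suc e) k))
      above : ∀ k' → k' ≡ k → ballotWalk n (suc (suc e)) ≡ 0ℤ
      above zero refl = vanish (suc (suc e)) (s≤s (ℕP.≤-reflexive (trans n≡ (ℕP.+-identityʳ (suc e)))))
      above (suc k') refl = odd (suc (suc e)) k' (trans n≡ ([1+e]+2[1+k]≡[2+e]+2k+1 e k'))

  ballotValues : ∀ n → BallotValues n
  ballotValues zero = ballotValues-zero
  ballotValues (suc n) = record
    { vanish = ballotValues-vanish V ; even = ballotValues-even V ; odd = ballotValues-odd V }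
    where
      V : BallotValues n
      V = ballotValues n


module NoncrossingIntertwining where

  open import Data.Nat as ℕ using (ℕ; zero; suc; _≤_; s≤s; z≤n; _∸_)
  import Data.Nat.Properties as ℕP
  open import Data.Integer as ℤ using (ℤ; +_; _+_; _*_; -_; _-_; 0ℤ; 1ℤ)
  open import Data.Integer.Properties using (+-identityʳ; +-identityˡ; *-zeroʳ; *-identityˡ; *-distribʳ-+; pos-+)
  open import Data.Integer.Tactic.RingSolver
  open import Relation.Binary.PropositionalEquality
  open IntSums
  open Binomial
  open NoncrossingPartitions using (stepNC)

  ncEmbed : (ℕ → ℤ) → ℕ → ℤ
  ncEmbed ψ d = Σℤ (λ e → + bin (d ∸ 1) e * ψ e) d

  ncEmbed-unitAt0 : ∀ d → 1 ≤ d → 1ℤ ≡ ncEmbed unitAt0 d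
  ncEmbed-unitAt0 (suc t) _ = sym (trans (Σℤ-front _ t) (trans (cong₂ _+_ (trans (cong (λ z → + z * 1ℤ) (bin-0 t)) refl) (Σℤ-zero t (λ e _ → *-zeroʳ (+ bin t (suc e))))) refl))

  ncEmbed-at1 : ∀ χ → ncEmbed χ 1 ≡ χ 0
  ncEmbed-at1 χ = trans (+-identityˡ _) (*-identityˡ (χ 0))

  ncEmbed-step : ∀ ψ t → ncEmbed ψ (suc (suc t)) ≡ ncEmbed ψ (suc t) + Σℤ (λ e → + bin t e * ψ (suc e)) (suc t)
  ncEmbed-step ψ t = begin
    Σℤ (λ e → + bin (suc t) e * ψ e) (suc (suc t))
      ≡⟨ Σℤ-front _ (suc t) ⟩
    + 1 * ψ 0 + Σℤ (λ e → + bin (suc t) (suc e) * ψ (suc e)) (suc t)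
      ≡⟨ cong (λ z → + 1 * ψ 0 + z) (trans (Σℤ-ext (suc t) (λ e → trans (cong (_* ψ (suc e)) (pos-+ (bin t e) (bin t (suc e)))) (*-distribʳ-+ (ψ (suc e)) (+ bin t e) (+ bin t (suc e))))) (Σℤ-+ _ _ (suc t))) ⟩
    + 1 * ψ 0 + (S1 + (S2 + + bin t (suc t) * ψ (suc t)))
      ≡⟨ cong (λ z → + 1 * ψ 0 + (S1 + (S2 + z * ψ (suc t)))) (cong +_ (bin-over t (suc t) ℕP.≤-refl)) ⟩
    + 1 * ψ 0 + (S1 + (S2 + + 0 * ψ (suc t)))
      ≡⟨ algebra (ψ 0) S1 S2 (ψ (suc t)) ⟩
    (+ 1 * ψ 0 + S2) + S1
      ≡⟨ cong (λ z → (z * ψ 0 + S2) + S1) (cong +_ (sym (bin-0 t))) ⟩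
    (+ bin t 0 * ψ 0 + S2) + S1
      ≡⟨ cong (_+ S1) (sym (Σℤ-front (λ e → + bin t e * ψ e) t)) ⟩
    ncEmbed ψ (suc t) + S1 ∎
    where
    open ≡-Reasoning
    S1 : ℤ
    S1 = Σℤ (λ e → + bin t e * ψ (suc e)) (suc t)
    S2 : ℤ
    S2 = Σℤ (λ e → + bin t (suc e) * ψ (suc e)) t
    algebra : ∀ p0 S1 S2 q → + 1 * p0 + (S1 + (S2 + + 0 * q)) ≡ (+ 1 * p0 + S2) + S1
    algebra = solve-∀

  ncEmbed-partial-sums : ∀ ψ t → Σℤ (λ r → ncEmbed ψ (suc r)) t ≡ Σℤ (λ e → + bin t (suc e) * ψ e) t
  ncEmbed-partial-sums ψ zero = refl
  ncEmbed-partial-sums ψ (suc t) = begin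
    Σℤ (λ r → ncEmbed ψ (suc r)) t + ncEmbed ψ (suc t)
      ≡⟨ cong (_+ ncEmbed ψ (suc t)) (ncEmbed-partial-sums ψ t) ⟩
    Σℤ (λ e → + bin t (suc e) * ψ e) t + ncEmbed ψ (suc t)
      ≡⟨ algebra (Σℤ (λ e → + bin t (suc e) * ψ e) t) (ncEmbed ψ (suc t)) (+ bin t (suc t) * ψ t) (cong (_* ψ t) (cong +_ (bin-over t (suc t) ℕP.≤-refl))) ⟩
    ncEmbed ψ (suc t) + (Σℤ (λ e → + bin t (suc e) * ψ e) t + + bin t (suc t) * ψ t)
      ≡⟨ sym (Σℤ-+ _ _ (suc t)) ⟩
    Σℤ (λ e → + bin t e * ψ e + + bin t (suc e) * ψ e) (suc t)
      ≡⟨ Σℤ-ext (suc t) (λ e → trans (sym (*-distribʳ-+ (ψ e) (+ bin t e) (+ bin t (suc e)))) (cong (_* ψ e) (sym (pos-+ (bin t e) (bin t (suc e)))))) ⟩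
    Σℤ (λ e → + bin (suc t) (suc e) * ψ e) (suc t) ∎
    where
    open ≡-Reasoning
    algebra : ∀ a b z → z ≡ + 0 * ψ t → a + b ≡ b + (a + z)
    algebra a b z e rewrite e = algebra₀ a b (ψ t)
      where algebra₀ : ∀ a b q → a + b ≡ b + (a + + 0 * q)
            algebra₀ = solve-∀

  module _ (x y : ℤ) where

    u : ℤ
    u = y + + 1

    shiftedNC : (ℕ → ℤ) → ℕ → ℤ
    shiftedNC φ d = stepNC x y φ d - u * φ d

    open BallotWalk x using (ballotStep)

    ncEmbed-ballotStep : ∀ ψ t → ncEmbed (ballotStep ψ) (suc t) ≡ Σℤ (λ e → + bin t e * ψ (suc e)) (suc t) + x * Σℤ (λ e → + bin t (suc e) * ψ e) t
    ncEmbed-ballotStep ψ t = begin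
      Σℤ (λ e → + bin t e * ballotStep ψ e) (suc t)
        ≡⟨ Σℤ-ext (suc t) pointwise ⟩
      Σℤ (λ e → + bin t e * ψ (suc e) + x * G e) (suc t)
        ≡⟨ trans (Σℤ-+ _ _ (suc t)) (cong (λ z → Σℤ (λ e → + bin t e * ψ (suc e)) (suc t) + z) (Σℤ-* x G (suc t))) ⟩
      Σℤ (λ e → + bin t e * ψ (suc e)) (suc t) + x * Σℤ G (suc t)
        ≡⟨ cong (λ z → Σℤ (λ e → + bin t e * ψ (suc e)) (suc t) + x * z) (trans (Σℤ-front G t) (+-identityˡ _)) ⟩
      Σℤ (λ e → + bin t e * ψ (suc e)) (suc t) + x * Σℤ (λ e → + bin t (suc e) * ψ e) t ∎
      where
      open ≡-Reasoning
      G : ℕ → ℤ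
      G zero = 0ℤ
      G (suc e) = + bin t (suc e) * ψ e
      pointwise : ∀ e → + bin t e * ballotStep ψ e ≡ + bin t e * ψ (suc e) + x * G e
      pointwise zero = sym (trans (cong (λ z → + bin t 0 * ψ 1 + z) (*-zeroʳ x)) (+-identityʳ _))
      pointwise (suc e) = algebra (+ bin t (suc e)) (ψ (suc (suc e))) (ψ e) x
        where algebra : ∀ b p q x → b * (p + x * q) ≡ b * p + x * (b * q)
              algebra = solve-∀

    ncEmbed-intertwines : ∀ ψ t → shiftedNC (ncEmbed ψ) (suc t) ≡ ncEmbed (ballotStep ψ) (suc t)
    ncEmbed-intertwines ψ t = begin
      ncEmbed ψ (suc (suc t)) + y * ncEmbed ψ (suc t) + x * Σℤ (λ r → ncEmbed ψ (suc r)) t - u * ncEmbed ψ (suc t)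
        ≡⟨ cong₂ (λ a b → a + y * ncEmbed ψ (suc t) + x * b - u * ncEmbed ψ (suc t)) (ncEmbed-step ψ t) (ncEmbed-partial-sums ψ t) ⟩
      (ncEmbed ψ (suc t) + S1) + y * ncEmbed ψ (suc t) + x * H - u * ncEmbed ψ (suc t)
        ≡⟨ algebra (ncEmbed ψ (suc t)) S1 H x y ⟩
      S1 + x * H
        ≡⟨ sym (ncEmbed-ballotStep ψ t) ⟩
      ncEmbed (ballotStep ψ) (suc t) ∎
      where
      open ≡-Reasoning
      S1 : ℤ
      S1 = Σℤ (λ e → + bin t e * ψ (suc e)) (suc t)
      H : ℤ
      H = Σℤ (λ e → + bin t (suc e) * ψ e) t
      algebra : ∀ P S1 H x y → (P + S1) + y * P + x * H - (y + + 1) * P ≡ S1 + x * H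
      algebra = solve-∀

    shiftedNC-cong₊ : ∀ {f g : ℕ → ℤ} → (∀ d → 1 ≤ d → f d ≡ g d) → ∀ d → 1 ≤ d → shiftedNC f d ≡ shiftedNC g d
    shiftedNC-cong₊ {f} {g} e d 1≤d = cong₂ _-_ (cong₂ _+_ (cong₂ _+_ (e (suc d) (s≤s z≤n)) (cong (y *_) (e d 1≤d))) (cong (x *_) (Σℤ-ext (d ∸ 1) (λ r → e (suc r) (s≤s z≤n))))) (cong (u *_) (e d 1≤d))

    iterShiftedNC-cong₊ : ∀ n {f g : ℕ → ℤ} → (∀ d → 1 ≤ d → f d ≡ g d) → ∀ d → 1 ≤ d → iter shiftedNC n f d ≡ iter shiftedNC n g d
    iterShiftedNC-cong₊ zero e d 1≤d = e d 1≤d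
    iterShiftedNC-cong₊ (suc n) e d 1≤d = iterShiftedNC-cong₊ n (shiftedNC-cong₊ e) d 1≤d

    ncEmbed-intertwines-iter : ∀ n ψ d → 1 ≤ d → iter shiftedNC n (ncEmbed ψ) d ≡ ncEmbed (iter ballotStep n ψ) d
    ncEmbed-intertwines-iter zero ψ d _ = refl
    ncEmbed-intertwines-iter (suc n) ψ d 1≤d = trans (iterShiftedNC-cong₊ n (λ { (suc t) _ → ncEmbed-intertwines ψ t }) d 1≤d) (ncEmbed-intertwines-iter n (ballotStep ψ) d 1≤d)


module Identities where

  open import Data.Nat as ℕ using (ℕ; suc; _∸_)
  import Data.Nat.Properties as ℕP
  open import Data.Nat.Combinatorics using (_C_)
  open import Data.Integer as ℤ using (ℤ; +_; -[1+_]; _+_; _*_; 1ℤ; _^_)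
  open import Relation.Binary.PropositionalEquality
  open import Defs
  open IntSums
  open Binomial
  open GrowthSums using (sumℤ-apply)
  open BinomialTransform
  open AllPartitions
  open FeasiblePartitions
  open NoncrossingPartitions
  open FeasibleIntertwining
  open NoncrossingIntertwining

  transform-as-Σℤ : ∀ (P : ℕ → ℤ) y n → transform P y n ≡ Σℤ (λ k → coeff (y + + 1) n k * P (suc k)) (suc n)
  transform-as-Σℤ P y n =
    trans (sumℤ-apply term (λ k → k) (suc n))
          (Σℤ-ext (suc n) (λ k → cong (λ b → (-[1+ 0 ] ^ (n ∸ k)) * (+ b) * ((y + + 1) ^ (n ∸ k)) * P (suc k)) (sym (bin≡C n k))))
    where
    term : ℕ → ℤ
    term k = (-[1+ 0 ] ^ (n ∸ k)) * (+ (n C k)) * ((y + + 1) ^ (n ∸ k)) * P (suc k)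

  module _ (x y : ℤ) where

    open BallotWalk x using (ballotWalk; ballotValues; module BallotValues)

    private
      module TransformAll = Transform (stepAll x y) (stepAll-cong x y) (stepAll-lin x y) (y + + 1)
      module TransformNC  = Transform (stepNC x y) (stepNC-cong x y) (stepNC-lin x y) (y + + 1)

    transform-𝓑 : ∀ n → transform (λ m → 𝓑 m x y) y n ≡ 𝓕 n x
    transform-𝓑 n = begin
      transform (λ m → 𝓑 m x y) y n
        ≡⟨ transform-as-Σℤ (λ m → 𝓑 m x y) y n ⟩
      Σℤ (λ k → coeff (y + + 1) n k * 𝓑 (suc k) x y) (suc n)
        ≡⟨ Σℤ-ext (suc n) (λ k → cong (coeff (y + + 1) n k *_) (𝓑-iterate x y k)) ⟩
      Σℤ (λ k → coeff (y + + 1) n k * iter (stepAll x y) k (λ _ → 1ℤ) 1) (suc n)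
        ≡⟨ TransformAll.transform-iterate n (λ _ → 1ℤ) 1 ⟩
      iter (shiftedAll x y) n (λ _ → 1ℤ) 1
        ≡⟨ sym (feasEmbed-at00 (iter (shiftedAll x y) n (λ _ → 1ℤ))) ⟩
      feasEmbed (iter (shiftedAll x y) n (λ _ → 1ℤ)) 0 0
        ≡⟨ sym (feasEmbed-intertwines-iter x y n (λ _ → 1ℤ) 0 0) ⟩
      iter (stepFeas x) n (feasEmbed (λ _ → 1ℤ)) 0 0
        ≡⟨ iterFeas-cong x y n feasEmbed-const 0 0 ⟩
      iter (stepFeas x) n unitAt00 0 0
        ≡⟨ sym (𝓕-iterate x n) ⟩
      𝓕 n x ∎
      where open ≡-Reasoning

    transform-𝓝-ballot : ∀ n → transform (λ j → 𝓝 j x y) y n ≡ ballotWalk n 0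
    transform-𝓝-ballot n = begin
      transform (λ j → 𝓝 j x y) y n
        ≡⟨ transform-as-Σℤ (λ j → 𝓝 j x y) y n ⟩
      Σℤ (λ k → coeff (y + + 1) n k * 𝓝 (suc k) x y) (suc n)
        ≡⟨ Σℤ-ext (suc n) (λ k → cong (coeff (y + + 1) n k *_) (𝓝-iterate x y k)) ⟩
      Σℤ (λ k → coeff (y + + 1) n k * iter (stepNC x y) k (λ _ → 1ℤ) 1) (suc n)
        ≡⟨ TransformNC.transform-iterate n (λ _ → 1ℤ) 1 ⟩
      iter (shiftedNC x y) n (λ _ → 1ℤ) 1
        ≡⟨ iterShiftedNC-cong₊ x y n ncEmbed-unitAt0 1 ℕP.≤-refl ⟩
      iter (shiftedNC x y) n (ncEmbed unitAt0) 1
        ≡⟨ ncEmbed-intertwines-iter x y n unitAt0 1 ℕP.≤-refl ⟩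
      ncEmbed (ballotWalk n) 1
        ≡⟨ ncEmbed-at1 (ballotWalk n) ⟩
      ballotWalk n 0 ∎
      where open ≡-Reasoning

    transform-𝓝-even : ∀ n m → n ≡ 2 ℕ.* m → transform (λ j → 𝓝 j x y) y n ≡ x ^ m * + catalan m
    transform-𝓝-even n m n≡2m = begin
      transform (λ j → 𝓝 j x y) y n   ≡⟨ transform-𝓝-ballot n ⟩
      ballotWalk n 0                   ≡⟨ BallotValues.even (ballotValues n) 0 m n≡2m ⟩
      x ^ m * + ballot m 0             ≡⟨ cong (λ c → x ^ m * + c) (sym (catalan-ballot m)) ⟩
      x ^ m * + catalan m              ∎
      where open ≡-Reasoning

    transform-𝓝-odd : ∀ n m → n ≡ 2 ℕ.* m ℕ.+ 1 → transform (λ j → 𝓝 j x y) y n ≡ + 0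
    transform-𝓝-odd n m n≡2m+1 =
      trans (transform-𝓝-ballot n) (BallotValues.odd (ballotValues n) 0 m n≡2m+1)


open import Defs
open import Data.Nat using (ℕ; suc; _*_; _+_)
open import Data.Integer using (ℤ; +_) renaming (_*_ to _*ℤ_; _^_ to _^ℤ_)
open import Data.Product using (_×_; _,_)
open import Relation.Binary.PropositionalEquality using (_≡_)
open Identities using (transform-𝓑; transform-𝓝-even; transform-𝓝-odd)

corollary3p5 : (n : ℕ) → (x y : ℤ) →
    (transform (λ m → 𝓑 m x y) y n ≡ 𝓕 n x)
    × ((∀ m → n ≡ 2 * m → transform (λ j → 𝓝 j x y) y n ≡ (x ^ℤ m) *ℤ (+ catalan m))
    × (∀ m → n ≡ 2 * m + 1 → transform (λ j → 𝓝 j x y) y n ≡ + 0))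
corollary3p5 n x y = transform-𝓑 x y n , transform-𝓝-even x y n , transform-𝓝-odd x y n
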